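{- Let $A$ be a symmetric $n\times n$ integer matrix all of whose diagonal entries are even. Then there is an integer matrix $P$ with $\det(P)=\pm1$ such that $P^TAP\pmod 4$ is a block diagonal matrix of the form $$\mathrm{diag}\Big(r\begin{pmatrix}2&1\\1&2\end{pmatrix},\ s\begin{pmatrix}0&1\\1&0\end{pmatrix},\ p\,(2),\ Z\Big),$$ where $p,r,s$ are non-negative integers and $Z$ is a symmetric matrix whose diagonal entries are all $0$ and each of whose non-zero entries equals $2$.
   Context: "$M\pmod 4$" is the entrywise reduction of $M$ modulo $4$ into $\{0,1,2,3\}$. $\mathrm{diag}(m_1A_1,\dots,m_kA_k)$ denotes the block diagonal matrix with $m_1$ copies of $A_1$, ..., $m_k$ copies of $A_k$ on the diagonal. -}

module Defs where

open import Data.Nat as ℕ using (ℕ; zero; suc)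
open import Data.Fin using (Fin; zero; suc; punchIn; splitAt)
open import Data.Sum using (inj₁; inj₂)
open import Data.Integer using (ℤ; +_; _+_; _*_; -_; _%ℕ_)

Mat : ℕ → Set
Mat n = Fin n → Fin n → ℤ

sumFin : ∀ {n} → (Fin n → ℤ) → ℤ
sumFin {zero}  f = + 0
sumFin {suc n} f = f zero + sumFin (λ i → f (suc i))

transpose : ∀ {n} → Mat n → Mat n
transpose M i j = M j i

infixl 7 _⊗_
_⊗_ : ∀ {n} → Mat n → Mat n → Mat n
(M ⊗ N) i j = sumFin (λ k → M i k * N k j)

sign : ∀ {n} → Fin n → ℤ
sign zero    = + 1
sign (suc i) = - sign i

det : ∀ {n} → Mat n → ℤ
det {zero}  M = + 1
det {suc n} M =
  sumFin (λ i → sign i * M i zero * det (λ a b → M (punchIn i a) (suc b)))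

mod4 : ℤ → ℤ
mod4 x = + (x %ℕ 4)

blockDiag : ∀ {a b} → Mat a → Mat b → Mat (a ℕ.+ b)
blockDiag {a} M N i j with splitAt a i | splitAt a j
... | inj₁ i' | inj₁ j' = M i' j'
... | inj₂ i' | inj₂ j' = N i' j'
... | _       | _       = + 0

copies : ∀ {d} (k : ℕ) → Mat d → Mat (k ℕ.* d)
copies zero    M ()
copies (suc k) M = blockDiag M (copies k M)

H₂ : Mat 2
H₂ zero    zero    = + 2
H₂ zero    (suc _) = + 1
H₂ (suc _) zero    = + 1
H₂ (suc _) (suc _) = + 2

U₂ : Mat 2
U₂ zero    zero    = + 0
U₂ zero    (suc _) = + 1
U₂ (suc _) zero    = + 1
U₂ (suc _) (suc _) = + 0

T₁ : Mat 1
T₁ _ _ = + 2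

normalForm : (r s p : ℕ) {m : ℕ} → Mat m →
             Mat (r ℕ.* 2 ℕ.+ (s ℕ.* 2 ℕ.+ (p ℕ.* 1 ℕ.+ m)))
normalForm r s p Z = blockDiag (copies r H₂) (blockDiag (copies s U₂) (blockDiag (copies p T₁) Z))

-- Base changes are built from shears e_j ↦ e_j + c_j e_l, whose determinant 1 + c_l is ±1 when
-- c_l ∈ {0, -2}; determinants are controlled through multilinearity and alternation of the Laplace
-- expansion. If some entry is odd, shears move an entry ≡ 1 to position (0,1) and make the diagonal
-- of that corner ≡ (2,2) or (0,0). An even diagonal makes the corner's determinant ≡ -1 (mod 4),
-- so its adjugate clears the rest of rows 0 and 1: a block ≡ H₂ or U₂ splits off. If a U₂ block is
-- followed by a block with an odd entry, the two are re-based into H₂ ⊕ (rest), so all H₂ blocks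
-- come first. Once every entry is even, each diagonal entry ≡ 2 splits off a (2); what is left has
-- diagonal ≡ 0 and entries in {0, 2} modulo 4, and is the block Z.

module Submission where

open import Defs
open import Data.Nat as ℕ using (ℕ; zero; suc)
import Data.Nat.DivMod as ℕD
open import Data.Fin using (Fin; zero; suc; punchIn; punchOut; _≟_; splitAt; cast; _↑ˡ_)
open import Data.Fin.Properties
  using (punchIn-injective; punchInᵢ≢i; punchIn-punchOut; punchOut-punchIn; punchOut-cong; punchOut-injective;
         any?; cast-is-id)
open import Data.Vec.Functional using (Vector; updateAt; removeAt; tail; map)
open import Data.Vec.Functional.Properties using (updateAt-updates; updateAt-minimal; updateAt-id-local)
open import Data.Integer using (ℤ; +_; -_; -[1+_]; +[1+_]; _+_; _*_; _-_; _%ℕ_; _/ℕ_)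
import Data.Integer.DivMod as ℤD
import Data.Integer.Properties as ℤP
open import Data.Integer.Divisibility using (_∣_)
open import Data.Integer.Divisibility.Signed as Signed
  using (divides; quotient; ∣-trans; ∣m∣n⇒∣m+n; ∣n⇒∣m*n; ∣m⇒∣-m; ∣ᵤ⇒∣)
open import Data.Integer.Tactic.RingSolver using (solve-∀)
open import Algebra.Properties.Semiring.Sum ℤP.+-*-semiring
  using (sum; sum-cong-≗; ∑-distrib-+; ∑-comm; sum-remove; sum-replicate-zero;
         *-distribˡ-sum; *-distribʳ-sum)
open import Data.Product using (Σ; ∃; _×_; _,_)
open import Data.Sum using (_⊎_; inj₁; inj₂)
open import Data.Empty using (⊥-elim)
open import Function using (_∘_; const)
open import Relation.Nullary using (¬_; Dec; yes; no)
open import Relation.Binary.PropositionalEquality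
  using (_≡_; _≢_; _≗_; refl; sym; trans; cong; cong₂; cong-app; subst; module ≡-Reasoning)
open ≡-Reasoning

sumFin≡sum : ∀ {n} (f : Fin n → ℤ) → sumFin f ≡ sum f
sumFin≡sum {zero}  f = refl
sumFin≡sum {suc n} f = cong (_+_ (f zero)) (sumFin≡sum (f ∘ suc))

sumFin-cong : ∀ {n} {f g : Fin n → ℤ} → f ≗ g → sumFin f ≡ sumFin g
sumFin-cong {f = f} {g} f≗g = begin
  sumFin f  ≡⟨ sumFin≡sum f ⟩
  sum f     ≡⟨ sum-cong-≗ f≗g ⟩
  sum g     ≡⟨ sumFin≡sum g ⟨
  sumFin g  ∎

sumFin-zero : ∀ {n} {f : Fin n → ℤ} → (∀ i → f i ≡ + 0) → sumFin f ≡ + 0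
sumFin-zero {n} f≗0 = trans (sumFin-cong f≗0) (trans (sumFin≡sum {n} (λ _ → + 0)) (sum-replicate-zero n))

sumFin-+ : ∀ {n} (f g : Fin n → ℤ) → sumFin (λ i → f i + g i) ≡ sumFin f + sumFin g
sumFin-+ f g = begin
  sumFin (λ i → f i + g i)  ≡⟨ sumFin≡sum (λ i → f i + g i) ⟩
  sum (λ i → f i + g i)     ≡⟨ ∑-distrib-+ f g ⟩
  sum f + sum g             ≡⟨ cong₂ _+_ (sumFin≡sum f) (sumFin≡sum g) ⟨
  sumFin f + sumFin g       ∎

sumFin-*ˡ : ∀ {n} (c : ℤ) (f : Fin n → ℤ) → sumFin (λ i → c * f i) ≡ c * sumFin f
sumFin-*ˡ c f = begin
  sumFin (λ i → c * f i)  ≡⟨ sumFin≡sum (λ i → c * f i) ⟩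
  sum (λ i → c * f i)     ≡⟨ *-distribˡ-sum c f ⟨
  c * sum f               ≡⟨ cong (c *_) (sumFin≡sum f) ⟨
  c * sumFin f            ∎

sumFin-*ʳ : ∀ {n} (c : ℤ) (f : Fin n → ℤ) → sumFin (λ i → f i * c) ≡ sumFin f * c
sumFin-*ʳ c f = begin
  sumFin (λ i → f i * c)  ≡⟨ sumFin≡sum (λ i → f i * c) ⟩
  sum (λ i → f i * c)     ≡⟨ *-distribʳ-sum c f ⟨
  sum f * c               ≡⟨ cong (_* c) (sumFin≡sum f) ⟨
  sumFin f * c            ∎

sumFin-scale : ∀ {n} (a : ℤ) (c x : Fin n → ℤ) →
  a * sumFin (λ k → c k * x k) ≡ sumFin (λ k → c k * (a * x k))
sumFin-scale a c x = trans (sym (sumFin-*ˡ a (λ k → c k * x k))) (sumFin-cong (λ k → swap a (c k) (x k)))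
  where
  swap : ∀ a c x → a * (c * x) ≡ c * (a * x)
  swap = solve-∀

sumFin-comm : ∀ {m n} (f : Fin m → Fin n → ℤ) →
  sumFin (λ i → sumFin (f i)) ≡ sumFin (λ j → sumFin (λ i → f i j))
sumFin-comm f = begin
  sumFin (λ i → sumFin (f i))               ≡⟨ sumFin-cong (λ i → sumFin≡sum (f i)) ⟩
  sumFin (λ i → sum (f i))                  ≡⟨ sumFin≡sum (λ i → sum (f i)) ⟩
  sum (λ i → sum (f i))                     ≡⟨ ∑-comm f ⟩
  sum (λ j → sum (λ i → f i j))             ≡⟨ sumFin≡sum (λ j → sum (λ i → f i j)) ⟨
  sumFin (λ j → sum (λ i → f i j))          ≡⟨ sumFin-cong (λ j → sumFin≡sum (λ i → f i j)) ⟨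
  sumFin (λ j → sumFin (λ i → f i j))       ∎

sumFin-pair : ∀ {n} (s t : ℤ) (f g : Fin n → ℤ) →
  s * sumFin f + t * sumFin g ≡ sumFin (λ k → s * f k + t * g k)
sumFin-pair s t f g = begin
  s * sumFin f + t * sumFin g                       ≡⟨ cong₂ _+_ (sumFin-*ˡ s f) (sumFin-*ˡ t g) ⟨
  sumFin (λ k → s * f k) + sumFin (λ k → t * g k)   ≡⟨ sumFin-+ (λ k → s * f k) (λ k → t * g k) ⟨
  sumFin (λ k → s * f k + t * g k)                  ∎

sumFin-remove : ∀ {n} (a : Fin (suc n)) (f : Fin (suc n) → ℤ) →
  sumFin f ≡ f a + sumFin (f ∘ punchIn a)
sumFin-remove a f = begin
  sumFin f                       ≡⟨ sumFin≡sum f ⟩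
  sum f                          ≡⟨ sum-remove f ⟩
  f a + sum (f ∘ punchIn a)      ≡⟨ cong (_+_ (f a)) (sumFin≡sum (f ∘ punchIn a)) ⟨
  f a + sumFin (f ∘ punchIn a)   ∎

sumFin-concentrated : ∀ {n} (a : Fin n) {f : Fin n → ℤ} →
  (∀ i → i ≢ a → f i ≡ + 0) → sumFin f ≡ f a
sumFin-concentrated {suc n} a {f} f≡0 = begin
  sumFin f                      ≡⟨ sumFin-remove a f ⟩
  f a + sumFin (f ∘ punchIn a)  ≡⟨ cong (_+_ (f a)) (sumFin-zero (λ i → f≡0 _ (punchInᵢ≢i a i))) ⟩
  f a + + 0                     ≡⟨ ℤP.+-identityʳ (f a) ⟩
  f a                           ∎

δ : ∀ {n} → Fin n → Fin n → ℤ
δ zero    zero    = + 1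
δ zero    (suc _) = + 0
δ (suc _) zero    = + 0
δ (suc i) (suc j) = δ i j

δ-refl : ∀ {n} (i : Fin n) → δ i i ≡ + 1
δ-refl zero    = refl
δ-refl (suc i) = δ-refl i

δ-≢ : ∀ {n} {i j : Fin n} → i ≢ j → δ i j ≡ + 0
δ-≢ {i = zero}  {zero}  i≢j = ⊥-elim (i≢j refl)
δ-≢ {i = zero}  {suc j} i≢j = refl
δ-≢ {i = suc i} {zero}  i≢j = refl
δ-≢ {i = suc i} {suc j} i≢j = δ-≢ (i≢j ∘ cong suc)

δ-sym : ∀ {n} (i j : Fin n) → δ i j ≡ δ j i
δ-sym zero    zero    = refl
δ-sym zero    (suc j) = refl
δ-sym (suc i) zero    = refl
δ-sym (suc i) (suc j) = δ-sym i j

sumFin-δˡ : ∀ {n} (j : Fin n) (f : Fin n → ℤ) → sumFin (λ k → δ k j * f k) ≡ f j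
sumFin-δˡ j f =
  trans (sumFin-concentrated j (λ k k≢j → trans (cong (_* f k) (δ-≢ k≢j)) (ℤP.*-zeroˡ (f k))))
        (trans (cong (_* f j) (δ-refl j)) (ℤP.*-identityˡ (f j)))

sumFin-δʳ : ∀ {n} (j : Fin n) (f : Fin n → ℤ) → sumFin (λ k → f k * δ k j) ≡ f j
sumFin-δʳ j f =
  trans (sumFin-concentrated j (λ k k≢j → trans (cong (f k *_) (δ-≢ k≢j)) (ℤP.*-zeroʳ (f k))))
        (trans (cong (f j *_) (δ-refl j)) (ℤP.*-identityʳ (f j)))

infix 4 _≈_
_≈_ : ∀ {n} → Mat n → Mat n → Set
M ≈ N = ∀ i j → M i j ≡ N i j

⊗-congˡ : ∀ {n} (N : Mat n) {M M′ : Mat n} → M ≈ M′ → M ⊗ N ≈ M′ ⊗ N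
⊗-congˡ N M≈M′ i j = sumFin-cong (λ k → cong (_* N k j) (M≈M′ i k))

⊗-congʳ : ∀ {n} (M : Mat n) {N N′ : Mat n} → N ≈ N′ → M ⊗ N ≈ M ⊗ N′
⊗-congʳ M N≈N′ i j = sumFin-cong (λ k → cong (M i k *_) (N≈N′ k j))

⊗-assoc : ∀ {n} (M N K : Mat n) → (M ⊗ N) ⊗ K ≈ M ⊗ (N ⊗ K)
⊗-assoc M N K i j = begin
    sumFin (λ k → sumFin (λ l → M i l * N l k) * K k j)
  ≡⟨ sumFin-cong (λ k → sumFin-*ʳ (K k j) (λ l → M i l * N l k)) ⟨
    sumFin (λ k → sumFin (λ l → M i l * N l k * K k j))
  ≡⟨ sumFin-comm (λ k l → M i l * N l k * K k j) ⟩
    sumFin (λ l → sumFin (λ k → M i l * N l k * K k j))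
  ≡⟨ sumFin-cong (λ l → trans (sumFin-cong (λ k → ℤP.*-assoc (M i l) (N l k) (K k j)))
                              (sumFin-*ˡ (M i l) (λ k → N l k * K k j))) ⟩
    sumFin (λ l → M i l * sumFin (λ k → N l k * K k j))
  ∎

transpose-⊗ : ∀ {n} (M N : Mat n) → transpose (M ⊗ N) ≈ transpose N ⊗ transpose M
transpose-⊗ M N i j = sumFin-cong (λ k → ℤP.*-comm (M j k) (N k i))

conj : ∀ {n} → Mat n → Mat n → Mat n
conj P A = transpose P ⊗ A ⊗ P

conj-cong : ∀ {n} (P : Mat n) {A B : Mat n} → A ≈ B → conj P A ≈ conj P B
conj-cong P A≈B = ⊗-congˡ P (⊗-congʳ (transpose P) A≈B)

conj-⊗ : ∀ {n} (T P A : Mat n) → conj (T ⊗ P) A ≈ conj P (conj T A)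
conj-⊗ T P A i j = begin
    (transpose (T ⊗ P) ⊗ A ⊗ (T ⊗ P)) i j
  ≡⟨ ⊗-congˡ (T ⊗ P) (⊗-congˡ A (transpose-⊗ T P)) i j ⟩
    (transpose P ⊗ transpose T ⊗ A ⊗ (T ⊗ P)) i j
  ≡⟨ ⊗-congˡ (T ⊗ P) (⊗-assoc (transpose P) (transpose T) A) i j ⟩
    (transpose P ⊗ (transpose T ⊗ A) ⊗ (T ⊗ P)) i j
  ≡⟨ ⊗-assoc (transpose P ⊗ (transpose T ⊗ A)) T P i j ⟨
    (transpose P ⊗ (transpose T ⊗ A) ⊗ T ⊗ P) i j
  ≡⟨ ⊗-congˡ P (⊗-assoc (transpose P) (transpose T ⊗ A) T) i j ⟩
    (transpose P ⊗ (transpose T ⊗ A ⊗ T) ⊗ P) i j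
  ∎

-- Determinants

infixl 6 _[_]≔_
_[_]≔_ : ∀ {a} {A : Set a} {n} → Vector A n → Fin n → A → Vector A n
xs [ i ]≔ x = updateAt xs i (const x)

minor : ∀ {n} → Mat (suc n) → Fin (suc n) → Mat n
minor M i a b = M (punchIn i a) (suc b)

det-cong : ∀ {n} {M N : Mat n} → M ≈ N → det M ≡ det N
det-cong {zero}  M≈N = refl
det-cong {suc n} M≈N = sumFin-cong λ i →
  cong₂ _*_ (cong (sign i *_) (M≈N i zero)) (det-cong (λ a b → M≈N (punchIn i a) (suc b)))

minor-[]≔-self : ∀ {n} (N : Mat (suc n)) i v → minor (N [ i ]≔ v) i ≈ minor N i
minor-[]≔-self N i v a b = cong-app (updateAt-minimal (punchIn i a) i N (punchInᵢ≢i i a)) (suc b)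

minor-[]≔ : ∀ {n} (N : Mat (suc n)) {i l} (l≢i : l ≢ i) v →
  minor (N [ i ]≔ v) l ≈ minor N l [ punchOut l≢i ]≔ tail v
minor-[]≔ N {i} {l} l≢i v a b with a ≟ punchOut l≢i
... | yes refl = begin
    (N [ i ]≔ v) (punchIn l (punchOut l≢i)) (suc b)
  ≡⟨ cong (λ r → (N [ i ]≔ v) r (suc b)) (punchIn-punchOut l≢i) ⟩
    (N [ i ]≔ v) i (suc b)
  ≡⟨ cong-app (updateAt-updates i N) (suc b) ⟩
    v (suc b)
  ≡⟨ cong-app (updateAt-updates (punchOut l≢i) (minor N l)) b ⟨
    (minor N l [ punchOut l≢i ]≔ tail v) (punchOut l≢i) b
  ∎
... | no a≢ = trans (cong-app (updateAt-minimal (punchIn l a) i N moved) (suc b))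
                    (sym (cong-app (updateAt-minimal a (punchOut l≢i) (minor N l) a≢) b))
  where
  moved : punchIn l a ≢ i
  moved e = a≢ (punchIn-injective l a (punchOut l≢i) (trans e (sym (punchIn-punchOut l≢i))))

det-linear : ∀ {m n} (N : Mat n) (i : Fin n) (c : Fin m → ℤ) (W : Fin m → Fin n → ℤ) →
  det (N [ i ]≔ (λ b → sumFin (λ k → c k * W k b))) ≡ sumFin (λ k → c k * det (N [ i ]≔ W k))
det-linear {n = suc n} N i c W = begin
    sumFin (term w)                                   ≡⟨ sumFin-cong expand ⟩
    sumFin (λ l → sumFin (λ k → c k * term (W k) l))  ≡⟨ sumFin-comm (λ l k → c k * term (W k) l) ⟩
    sumFin (λ k → sumFin (λ l → c k * term (W k) l))  ≡⟨ sumFin-cong (λ k → sumFin-*ˡ (c k) (term (W k))) ⟩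
    sumFin (λ k → c k * sumFin (term (W k)))          ∎
  where
  w : Fin (suc n) → ℤ
  w b = sumFin (λ k → c k * W k b)
  term : (Fin (suc n) → ℤ) → Fin (suc n) → ℤ
  term v l = sign l * (N [ i ]≔ v) l zero * det (minor (N [ i ]≔ v) l)
  expand : ∀ l → term w l ≡ sumFin (λ k → c k * term (W k) l)
  expand l with l ≟ i
  ... | yes refl = begin
      term w l                              ≡⟨ term-self w ⟩
      a * sumFin (λ k → c k * W k zero)     ≡⟨ sumFin-scale a c (λ k → W k zero) ⟩
      sumFin (λ k → c k * (a * W k zero))   ≡⟨ sumFin-cong (λ k → cong (c k *_) (sym (term-self (W k)))) ⟩
      sumFin (λ k → c k * term (W k) l)     ∎
    where
    a : ℤ
    a = sign l * det (minor N l)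
    swap : ∀ s x d → s * x * d ≡ s * d * x
    swap = solve-∀
    term-self : ∀ v → term v l ≡ a * v zero
    term-self v = trans (cong₂ (λ x D → sign l * x * D) (cong-app (updateAt-updates l N) zero)
                                                         (det-cong (minor-[]≔-self N l v)))
                        (swap (sign l) (v zero) (det (minor N l)))
  ... | no l≢i = begin
        term w l
      ≡⟨ term-other w ⟩
        a * det (minor N l [ punchOut l≢i ]≔ tail w)
      ≡⟨ cong (a *_) (det-linear (minor N l) (punchOut l≢i) c (tail ∘ W)) ⟩
        a * sumFin (λ k → c k * D k)
      ≡⟨ sumFin-scale a c D ⟩
        sumFin (λ k → c k * (a * D k))
      ≡⟨ sumFin-cong (λ k → cong (c k *_) (sym (term-other (W k)))) ⟩
        sumFin (λ k → c k * term (W k) l)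
      ∎
    where
    a : ℤ
    a = sign l * N l zero
    D : Fin _ → ℤ
    D k = det (minor N l [ punchOut l≢i ]≔ tail (W k))
    term-other : ∀ v → term v l ≡ a * det (minor N l [ punchOut l≢i ]≔ tail v)
    term-other v = cong₂ (λ x D → sign l * x * D) (cong-app (updateAt-minimal l i N l≢i) zero)
                                                   (det-cong (minor-[]≔ N l≢i v))

sign-punchOut : ∀ {n} {a x : Fin (suc n)} (a≢x : a ≢ x) (x≢a : x ≢ a) →
  sign a * sign (punchOut a≢x) ≡ - (sign x * sign (punchOut x≢a))
sign-punchOut {a = zero} {zero} a≢x _ = ⊥-elim (a≢x refl)
sign-punchOut {suc n} {zero} {suc x} _ _ = lemma (sign x)
  where
  lemma : ∀ s → + 1 * s ≡ - (- s * + 1)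
  lemma = solve-∀
sign-punchOut {suc n} {suc a} {zero} _ _ = lemma (sign a)
  where
  lemma : ∀ s → - s * + 1 ≡ - (+ 1 * s)
  lemma = solve-∀
sign-punchOut {suc n} {suc a} {suc x} a≢x x≢a = begin
  - sign a * - sign (punchOut (a≢x ∘ cong suc))    ≡⟨ neg-neg (sign a) _ ⟩
  sign a * sign (punchOut (a≢x ∘ cong suc))        ≡⟨ sign-punchOut (a≢x ∘ cong suc) (x≢a ∘ cong suc) ⟩
  - (sign x * sign (punchOut (x≢a ∘ cong suc)))    ≡⟨ cong -_ (neg-neg (sign x) _) ⟨
  - (- sign x * - sign (punchOut (x≢a ∘ cong suc))) ∎
  where
  neg-neg : ∀ s t → - s * - t ≡ s * t
  neg-neg = solve-∀

punchIn-punchOut-comm : ∀ {n} {a x : Fin (suc (suc n))} (a≢x : a ≢ x) (x≢a : x ≢ a) (c : Fin n) →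
  punchIn a (punchIn (punchOut a≢x) c) ≡ punchIn x (punchIn (punchOut x≢a) c)
punchIn-punchOut-comm {a = zero}  {zero}  a≢x _ _ = ⊥-elim (a≢x refl)
punchIn-punchOut-comm {a = zero}  {suc x} _ _ _ = refl
punchIn-punchOut-comm {a = suc a} {zero}  _ _ _ = refl
punchIn-punchOut-comm {a = suc a} {suc x} _ _ zero = refl
punchIn-punchOut-comm {suc n} {suc a} {suc x} a≢x x≢a (suc c) =
  cong suc (punchIn-punchOut-comm (a≢x ∘ cong suc) (x≢a ∘ cong suc) c)

punchOut-by-punchIn : ∀ {n} {c x : Fin (suc n)} {y} → punchIn c y ≡ x → (c≢x : c ≢ x) → punchOut c≢x ≡ y
punchOut-by-punchIn {c = c} e c≢x = trans (punchOut-cong c (sym e)) (punchOut-punchIn c)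

sign-punchIn : ∀ {n} {c x : Fin (suc n)} {y} → punchIn c y ≡ x → (x≢c : x ≢ c) →
  sign c * sign y ≡ - (sign x * sign (punchOut x≢c))
sign-punchIn {c = c} e x≢c =
  trans (cong (λ t → sign c * sign t) (sym (punchOut-by-punchIn e (x≢c ∘ sym))))
        (sign-punchOut (x≢c ∘ sym) x≢c)

removeAt-removeAt : ∀ {a} {A : Set a} {n} (R : Vector A (suc (suc n))) {c x y} →
  punchIn c y ≡ x → (x≢c : x ≢ c) → removeAt (removeAt R c) y ≗ removeAt (removeAt R x) (punchOut x≢c)
removeAt-removeAt R {c} e x≢c u = cong R
  (trans (cong (λ t → punchIn c (punchIn t u)) (sym (punchOut-by-punchIn e (x≢c ∘ sym))))
         (punchIn-punchOut-comm (x≢c ∘ sym) x≢c u))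

SignedMinorsCancel : ℕ → Set
SignedMinorsCancel n = ∀ (R : Vector (Vector ℤ n) (suc n)) {a b} → a ≢ b → R a ≡ R b →
  sign a * det (removeAt R a) + sign b * det (removeAt R b) ≡ + 0

module FirstColumnExpansion {n} (R : Vector (Vector ℤ (suc n)) (suc (suc n)))
                            {a b} (a≢b : a ≢ b) (Ra≡Rb : R a ≡ R b) where

  term : Fin (suc (suc n)) → Fin (suc n) → ℤ
  term c i = sign i * R (punchIn c i) zero * det (removeAt (removeAt (map tail R) c) i)

  i₀ j₀ : Fin (suc n)
  i₀ = punchOut a≢b
  j₀ = punchOut (a≢b ∘ sym)

  central-terms-cancel : sign a * term a i₀ + sign b * term b j₀ ≡ + 0
  central-terms-cancel = begin
      sign a * term a i₀ + sign b * term b j₀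
    ≡⟨ cong₂ (λ u v → sign a * u + sign b * v)
         (cong (λ r → sign i₀ * r * D) (cong (λ z → R z zero) (punchIn-punchOut a≢b)))
         (cong₂ (λ r D → sign j₀ * r * D)
           (trans (cong (λ z → R z zero) (punchIn-punchOut (a≢b ∘ sym))) (cong-app Ra≡Rb zero))
           (det-cong (λ u → cong-app (removeAt-removeAt (map tail R) (punchIn-punchOut (a≢b ∘ sym)) a≢b u)))) ⟩
      sign a * (sign i₀ * R b zero * D) + sign b * (sign j₀ * R b zero * D)
    ≡⟨ factor (sign a) (sign i₀) (sign b) (sign j₀) (R b zero) D ⟩
      (sign a * sign i₀ + sign b * sign j₀) * (R b zero * D)
    ≡⟨ cong (λ z → (z + sign b * sign j₀) * (R b zero * D)) (sign-punchOut a≢b (a≢b ∘ sym)) ⟩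
      (- (sign b * sign j₀) + sign b * sign j₀) * (R b zero * D)
    ≡⟨ vanish (sign b * sign j₀) (R b zero * D) ⟩
      + 0
    ∎
    where
    D = det (removeAt (removeAt (map tail R) a) i₀)
    factor : ∀ s i t j r D → s * (i * r * D) + t * (j * r * D) ≡ (s * i + t * j) * (r * D)
    factor = solve-∀
    vanish : ∀ u v → (- u + u) * v ≡ + 0
    vanish = solve-∀

  -- Every other row x of R occurs in both expansions; its two terms are ± R x 0 times the two
  -- signed minors of R with row x removed, which cancel one size down.
  other-terms-cancel : SignedMinorsCancel n → ∀ k →
    sign a * term a (punchIn i₀ k) + sign b * term b (punchIn j₀ k) ≡ + 0
  other-terms-cancel cancel k = begin
      sign a * term a i + sign b * term b j
    ≡⟨ cong₂ (λ u v → sign a * u + sign b * v)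
         (cong (λ D → sign i * r * D) (det-cong (λ u → cong-app (removeAt-removeAt (map tail R) xa x≢a u))))
         (cong₂ (λ r D → sign j * r * D) (cong (λ z → R z zero) xb)
                                          (det-cong (λ u → cong-app (removeAt-removeAt (map tail R) xb x≢b u)))) ⟩
      sign a * (sign i * r * D a′) + sign b * (sign j * r * D b′)
    ≡⟨ expand (sign a) (sign i) (sign b) (sign j) r (D a′) (D b′) ⟩
      r * ((sign a * sign i) * D a′ + (sign b * sign j) * D b′)
    ≡⟨ cong (r *_) (cong₂ (λ u v → u * D a′ + v * D b′) (sign-punchIn xa x≢a) (sign-punchIn xb x≢b)) ⟩
      r * (- (sign x * sign a′) * D a′ + - (sign x * sign b′) * D b′)
    ≡⟨ cong (r *_) (negate (sign x) (sign a′) (D a′) (sign b′) (D b′)) ⟩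
      r * - (sign x * (sign a′ * D a′ + sign b′ * D b′))
    ≡⟨ cong (λ z → r * - (sign x * z)) (cancel S a′≢b′ Sa′≡Sb′) ⟩
      r * - (sign x * + 0)
    ≡⟨ vanish r (sign x) ⟩
      + 0
    ∎
    where
    i j : Fin (suc n)
    i = punchIn i₀ k
    j = punchIn j₀ k
    x : Fin (suc (suc n))
    x = punchIn a i
    xa : punchIn a i ≡ x
    xa = refl
    xb : punchIn b j ≡ x
    xb = sym (punchIn-punchOut-comm a≢b (a≢b ∘ sym) k)
    x≢a : x ≢ a
    x≢a = punchInᵢ≢i a i
    x≢b : x ≢ b
    x≢b e = punchInᵢ≢i b j (trans xb e)
    r : ℤ
    r = R x zero
    S : Vector (Vector ℤ n) (suc n)
    S = removeAt (map tail R) x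
    D : Fin (suc n) → ℤ
    D y = det (removeAt S y)
    a′ b′ : Fin (suc n)
    a′ = punchOut x≢a
    b′ = punchOut x≢b
    a′≢b′ : a′ ≢ b′
    a′≢b′ e = a≢b (punchOut-injective x≢a x≢b e)
    Sa′≡Sb′ : S a′ ≡ S b′
    Sa′≡Sb′ = cong tail (trans (cong R (punchIn-punchOut x≢a))
                                (trans Ra≡Rb (cong R (sym (punchIn-punchOut x≢b)))))
    expand : ∀ s i t j r D E → s * (i * r * D) + t * (j * r * E) ≡ r * ((s * i) * D + (t * j) * E)
    expand = solve-∀
    negate : ∀ s u D v E → - (s * u) * D + - (s * v) * E ≡ - (s * (u * D + v * E))
    negate = solve-∀
    vanish : ∀ r s → r * - (s * + 0) ≡ + 0
    vanish = solve-∀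

signed-minors-cancel : ∀ n → SignedMinorsCancel n
signed-minors-cancel zero    R {zero} {zero} a≢b _ = ⊥-elim (a≢b refl)
signed-minors-cancel (suc n) R {a} {b} a≢b Ra≡Rb = begin
    sign a * sumFin (term a) + sign b * sumFin (term b)
  ≡⟨ cong₂ (λ u v → sign a * u + sign b * v) (sumFin-remove i₀ (term a)) (sumFin-remove j₀ (term b)) ⟩
    sign a * (term a i₀ + sumFin (term a ∘ punchIn i₀)) + sign b * (term b j₀ + sumFin (term b ∘ punchIn j₀))
  ≡⟨ regroup (sign a) (sign b) (term a i₀) (term b j₀) _ _ ⟩
    (sign a * term a i₀ + sign b * term b j₀)
      + (sign a * sumFin (term a ∘ punchIn i₀) + sign b * sumFin (term b ∘ punchIn j₀))
  ≡⟨ cong (_+_ (sign a * term a i₀ + sign b * term b j₀))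
          (sumFin-pair (sign a) (sign b) (term a ∘ punchIn i₀) (term b ∘ punchIn j₀)) ⟩
    (sign a * term a i₀ + sign b * term b j₀)
      + sumFin (λ k → sign a * term a (punchIn i₀ k) + sign b * term b (punchIn j₀ k))
  ≡⟨ cong₂ _+_ central-terms-cancel (sumFin-zero (other-terms-cancel (signed-minors-cancel n))) ⟩
    + 0
  ∎
  where
  open FirstColumnExpansion R a≢b Ra≡Rb
  regroup : ∀ s t x y u v → s * (x + u) + t * (y + v) ≡ (s * x + t * y) + (s * u + t * v)
  regroup = solve-∀

det-two-minors : ∀ {n} (N : Mat (suc (suc n))) {a b} → a ≢ b →
  (∀ x → x ≢ a → x ≢ b → det (minor N x) ≡ + 0) →
  det N ≡ sign a * N a zero * det (minor N a) + sign b * N b zero * det (minor N b)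
det-two-minors {n} N {a} {b} a≢b vanish = begin
    sumFin F
  ≡⟨ sumFin-remove a F ⟩
    F a + sumFin (F ∘ punchIn a)
  ≡⟨ cong (_+_ (F a)) (sumFin-remove i₀ (F ∘ punchIn a)) ⟩
    F a + (F (punchIn a i₀) + sumFin (F ∘ punchIn a ∘ punchIn i₀))
  ≡⟨ cong₂ (λ u v → F a + (F u + v)) (punchIn-punchOut a≢b) (sumFin-zero others) ⟩
    F a + (F b + + 0)
  ≡⟨ cong (_+_ (F a)) (ℤP.+-identityʳ (F b)) ⟩
    F a + F b
  ∎
  where
  F : Fin _ → ℤ
  F l = sign l * N l zero * det (minor N l)
  i₀ : Fin (suc n)
  i₀ = punchOut a≢b
  others : ∀ k → F (punchIn a (punchIn i₀ k)) ≡ + 0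
  others k = trans (cong (sign x * N x zero *_) (vanish x x≢a x≢b)) (ℤP.*-zeroʳ (sign x * N x zero))
    where
    x : Fin (suc (suc n))
    x = punchIn a (punchIn i₀ k)
    x≢a : x ≢ a
    x≢a = punchInᵢ≢i a _
    x≢b : x ≢ b
    x≢b e = punchInᵢ≢i i₀ k (punchIn-injective a _ _ (trans e (sym (punchIn-punchOut a≢b))))

det-equal-rows : ∀ {n} (N : Mat n) {a b} → a ≢ b → N a ≡ N b → det N ≡ + 0
det-equal-rows {suc zero} N {zero} {zero} a≢b _ = ⊥-elim (a≢b refl)
det-equal-rows {suc (suc n)} N {a} {b} a≢b Na≡Nb = begin
    det N
  ≡⟨ det-two-minors N a≢b (λ x x≢a x≢b →
       det-equal-rows (minor N x) (λ e → a≢b (punchOut-injective x≢a x≢b e))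
         (cong tail (trans (cong N (punchIn-punchOut x≢a))
                           (trans Na≡Nb (cong N (sym (punchIn-punchOut x≢b))))))) ⟩
    sign a * N a zero * det (minor N a) + sign b * N b zero * det (minor N b)
  ≡⟨ cong (λ u → sign a * u * det (minor N a) + sign b * N b zero * det (minor N b)) (cong-app Na≡Nb zero) ⟩
    sign a * N b zero * det (minor N a) + sign b * N b zero * det (minor N b)
  ≡⟨ factor (sign a) (sign b) (N b zero) (det (minor N a)) (det (minor N b)) ⟩
    N b zero * (sign a * det (minor N a) + sign b * det (minor N b))
  ≡⟨ cong (N b zero *_) (signed-minors-cancel (suc n) (map tail N) a≢b (cong tail Na≡Nb)) ⟩
    N b zero * + 0
  ≡⟨ ℤP.*-zeroʳ (N b zero) ⟩
    + 0
  ∎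
  where
  factor : ∀ s t r D E → s * r * D + t * r * E ≡ r * (s * D + t * E)
  factor = solve-∀

det-[]≔-row : ∀ {n} (N : Mat n) (l k : Fin n) → det (N [ l ]≔ N k) ≡ δ k l * det N
det-[]≔-row N l k with k ≟ l
... | yes refl = trans (det-cong (λ a → cong-app (updateAt-id-local k N refl a)))
                       (sym (trans (cong (_* det N) (δ-refl k)) (ℤP.*-identityˡ (det N))))
... | no k≢l = trans (det-equal-rows (N [ l ]≔ N k) k≢l
                       (trans (updateAt-minimal k l N k≢l) (sym (updateAt-updates l N))))
                     (sym (trans (cong (_* det N) (δ-≢ k≢l)) (ℤP.*-zeroˡ (det N))))

-- Column j of shear l c is e_j + c_j e_l, so conj (shear l c) A is the Gram matrix of A in the
-- basis (e_j + c_j e_l)_j.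
shear : ∀ {n} → Fin n → (Fin n → ℤ) → Mat n
shear l c a b = δ a b + δ a l * c b

shear-⊗ : ∀ {n} (l : Fin n) (c : Fin n → ℤ) (N : Mat n) →
  shear l c ⊗ N ≈ N [ l ]≔ (λ b → sumFin (λ k → (δ l k + c k) * N k b))
shear-⊗ l c N a b with a ≟ l
... | yes refl = trans (sumFin-cong (λ k → cong (λ d → (δ a k + d * c k) * N k b) (δ-refl a)))
                       (trans (sumFin-cong (λ k → cong (λ e → (δ a k + e) * N k b) (ℤP.*-identityˡ (c k))))
                              (sym (cong-app (updateAt-updates a N) b)))
... | no a≢l = begin
  sumFin (λ k → (δ a k + δ a l * c k) * N k b)  ≡⟨ sumFin-cong (λ k → cong (λ d → (δ a k + d * c k) * N k b)
                                                                         (δ-≢ a≢l)) ⟩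
  sumFin (λ k → (δ a k + + 0 * c k) * N k b)    ≡⟨ sumFin-cong (λ k → cong (_* N k b) (drop (δ a k) (c k))) ⟩
  sumFin (λ k → δ a k * N k b)                  ≡⟨ sumFin-cong (λ k → cong (_* N k b) (δ-sym a k)) ⟩
  sumFin (λ k → δ k a * N k b)                  ≡⟨ sumFin-δˡ a (λ k → N k b) ⟩
  N a b                                         ≡⟨ cong-app (updateAt-minimal a l N a≢l) b ⟨
  (N [ l ]≔ _) a b                              ∎
  where
  drop : ∀ d c → d + + 0 * c ≡ d
  drop = solve-∀

det-shear-⊗ : ∀ {n} (l : Fin n) (c : Fin n → ℤ) (N : Mat n) → det (shear l c ⊗ N) ≡ (+ 1 + c l) * det N
det-shear-⊗ l c N = begin
    det (shear l c ⊗ N)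
  ≡⟨ det-cong (shear-⊗ l c N) ⟩
    det (N [ l ]≔ (λ b → sumFin (λ k → (δ l k + c k) * N k b)))
  ≡⟨ det-linear N l (λ k → δ l k + c k) N ⟩
    sumFin (λ k → (δ l k + c k) * det (N [ l ]≔ N k))
  ≡⟨ sumFin-cong (λ k → cong ((δ l k + c k) *_) (det-[]≔-row N l k)) ⟩
    sumFin (λ k → (δ l k + c k) * (δ k l * det N))
  ≡⟨ sumFin-concentrated l (λ k k≢l → trans (cong (λ d → (δ l k + c k) * (d * det N)) (δ-≢ k≢l))
                                            (vanish (δ l k + c k) (det N))) ⟩
    (δ l l + c l) * (δ l l * det N)
  ≡⟨ cong (λ d → (d + c l) * (d * det N)) (δ-refl l) ⟩
    (+ 1 + c l) * (+ 1 * det N)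
  ≡⟨ cong ((+ 1 + c l) *_) (ℤP.*-identityˡ (det N)) ⟩
    (+ 1 + c l) * det N
  ∎
  where
  vanish : ∀ u d → u * (+ 0 * d) ≡ + 0
  vanish = solve-∀

-- Unimodular base changes

Id : ∀ {n} → Mat n
Id = δ

conj-Id : ∀ {n} (A : Mat n) → conj Id A ≈ A
conj-Id A i j = trans (sumFin-cong (λ m → cong (_* δ m j) (sumFin-δˡ i (λ l → A l m)))) (sumFin-δʳ j (A i))

extend : ∀ {n} → Mat n → Mat (suc n)
extend P = blockDiag (λ _ _ → + 1) P

det-extend : ∀ {n} (P : Mat n) → det (extend P) ≡ det P
det-extend {n} P = trans (cong₂ _+_ (ℤP.*-identityˡ (det P)) (sumFin-zero {n} (λ i → vanish (sign (suc i)) _)))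
                     (ℤP.+-identityʳ (det P))
  where
  vanish : ∀ s D → s * + 0 * D ≡ + 0
  vanish = solve-∀

Id≈extend-Id : ∀ {n} → Id {suc n} ≈ extend Id
Id≈extend-Id zero    zero    = refl
Id≈extend-Id zero    (suc j) = refl
Id≈extend-Id (suc i) zero    = refl
Id≈extend-Id (suc i) (suc j) = refl

det-Id : ∀ {n} → det (Id {n}) ≡ + 1
det-Id {zero}  = refl
det-Id {suc n} = trans (det-cong (Id≈extend-Id {n})) (trans (det-extend (Id {n})) (det-Id {n}))

IsUnit : ℤ → Set
IsUnit x = x ≡ + 1 ⊎ x ≡ - (+ 1)

isUnit-* : ∀ {x y} → IsUnit x → IsUnit y → IsUnit (x * y)
isUnit-* (inj₁ refl) (inj₁ refl) = inj₁ refl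
isUnit-* (inj₁ refl) (inj₂ refl) = inj₂ refl
isUnit-* (inj₂ refl) (inj₁ refl) = inj₂ refl
isUnit-* (inj₂ refl) (inj₂ refl) = inj₁ refl

Unimodular : ∀ {n} → Mat n → Set
Unimodular P = IsUnit (det P)

unimodular-Id : ∀ {n} → Unimodular (Id {n})
unimodular-Id {n} = inj₁ (det-Id {n})

unimodular-extend : ∀ {n} (P : Mat n) → Unimodular P → Unimodular (extend P)
unimodular-extend P = subst IsUnit (sym (det-extend P))

Admissible : ∀ {n} → Fin n → (Fin n → ℤ) → Set
Admissible l c = c l ≡ + 0 ⊎ c l ≡ - (+ 2)

unimodular-shear-⊗ : ∀ {n} (l : Fin n) c (P : Mat n) → Admissible l c → Unimodular P →
  Unimodular (shear l c ⊗ P)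
unimodular-shear-⊗ l c P adm uni = subst IsUnit (sym (det-shear-⊗ l c P)) (isUnit-* (unit-factor adm) uni)
  where
  unit-factor : Admissible l c → IsUnit (+ 1 + c l)
  unit-factor (inj₁ cₗ≡0)  = inj₁ (cong (_+_ (+ 1)) cₗ≡0)
  unit-factor (inj₂ cₗ≡-2) = inj₂ (cong (_+_ (+ 1)) cₗ≡-2)

lower : ∀ {n} → Mat (suc n) → Mat n
lower A a b = A (suc a) (suc b)

bordered : ∀ {n} → ℤ → (Fin n → ℤ) → (Fin n → ℤ) → Mat n → Mat (suc n)
bordered a u v M zero    zero    = a
bordered a u v M zero    (suc j) = u j
bordered a u v M (suc i) zero    = v i
bordered a u v M (suc i) (suc j) = M i j

module _ {n} (P : Mat n) where

  extend-sumˡ-zero : ∀ (f : Fin (suc n) → ℤ) → sumFin (λ l → extend P l zero * f l) ≡ f zero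
  extend-sumˡ-zero f = trans (cong₂ _+_ (ℤP.*-identityˡ (f zero)) (sumFin-zero (λ l → ℤP.*-zeroˡ (f (suc l)))))
                             (ℤP.+-identityʳ (f zero))

  extend-sumˡ-suc : ∀ i (f : Fin (suc n) → ℤ) →
    sumFin (λ l → extend P l (suc i) * f l) ≡ sumFin (λ l → P l i * f (suc l))
  extend-sumˡ-suc i f = trans (cong (_+ rest) (ℤP.*-zeroˡ (f zero))) (ℤP.+-identityˡ rest)
    where
    rest : ℤ
    rest = sumFin (λ l → P l i * f (suc l))

  extend-sumʳ-zero : ∀ (f : Fin (suc n) → ℤ) → sumFin (λ m → f m * extend P m zero) ≡ f zero
  extend-sumʳ-zero f = trans (cong₂ _+_ (ℤP.*-identityʳ (f zero)) (sumFin-zero (λ m → ℤP.*-zeroʳ (f (suc m)))))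
                             (ℤP.+-identityʳ (f zero))

  extend-sumʳ-suc : ∀ j (f : Fin (suc n) → ℤ) →
    sumFin (λ m → f m * extend P m (suc j)) ≡ sumFin (λ m → f (suc m) * P m j)
  extend-sumʳ-suc j f = trans (cong (_+ rest) (ℤP.*-zeroʳ (f zero))) (ℤP.+-identityˡ rest)
    where
    rest : ℤ
    rest = sumFin (λ m → f (suc m) * P m j)

  conj-extend : ∀ (Y : Mat (suc n)) →
    conj (extend P) Y ≈ bordered (Y zero zero) (λ j → sumFin (λ m → Y zero (suc m) * P m j))
                                  (λ i → sumFin (λ l → P l i * Y (suc l) zero))
                                  (conj P (lower Y))
  conj-extend Y zero zero =
    trans (extend-sumʳ-zero (λ m → sumFin (λ l → extend P l zero * Y l m))) (extend-sumˡ-zero (λ l → Y l zero))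
  conj-extend Y zero (suc j) =
    trans (extend-sumʳ-suc j (λ m → sumFin (λ l → extend P l zero * Y l m)))
          (sumFin-cong (λ m → cong (_* P m j) (extend-sumˡ-zero (λ l → Y l (suc m)))))
  conj-extend Y (suc i) zero =
    trans (extend-sumʳ-zero (λ m → sumFin (λ l → extend P l (suc i) * Y l m)))
          (extend-sumˡ-suc i (λ l → Y l zero))
  conj-extend Y (suc i) (suc j) =
    trans (extend-sumʳ-suc j (λ m → sumFin (λ l → extend P l (suc i) * Y l m)))
          (sumFin-cong (λ m → cong (_* P m j) (extend-sumˡ-suc i (λ l → Y l (suc m)))))

conj-extend-blockDiag₁ : ∀ {n} (P : Mat n) (B : Mat 1) (M : Mat n) →
  conj (extend P) (blockDiag B M) ≈ blockDiag B (conj P M)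
conj-extend-blockDiag₁ P B M zero    zero    = conj-extend P (blockDiag B M) zero zero
conj-extend-blockDiag₁ P B M zero    (suc j) =
  trans (conj-extend P (blockDiag B M) zero (suc j)) (sumFin-zero (λ m → ℤP.*-zeroˡ (P m j)))
conj-extend-blockDiag₁ P B M (suc i) zero    =
  trans (conj-extend P (blockDiag B M) (suc i) zero) (sumFin-zero (λ l → ℤP.*-zeroʳ (P l i)))
conj-extend-blockDiag₁ P B M (suc i) (suc j) = conj-extend P (blockDiag B M) (suc i) (suc j)

conj-extend-blockDiag₂ : ∀ {n} (P : Mat n) (B : Mat 2) (M : Mat n) →
  conj (extend (extend P)) (blockDiag B M) ≈ blockDiag B (conj P M)
conj-extend-blockDiag₂ P B M zero zero = conj-extend (extend P) (blockDiag B M) zero zero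
conj-extend-blockDiag₂ P B M zero (suc j) = trans (conj-extend (extend P) (blockDiag B M) zero (suc j)) (first-row j)
  where
  first-row : ∀ j →
    sumFin (λ m → blockDiag B M zero (suc m) * extend P m j) ≡ blockDiag B (conj P M) zero (suc j)
  first-row zero    = extend-sumʳ-zero P (λ m → blockDiag B M zero (suc m))
  first-row (suc j) = trans (extend-sumʳ-suc P j (λ m → blockDiag B M zero (suc m)))
                            (sumFin-zero (λ m → ℤP.*-zeroˡ (P m j)))
conj-extend-blockDiag₂ P B M (suc i) zero = trans (conj-extend (extend P) (blockDiag B M) (suc i) zero) (first-column i)
  where
  first-column : ∀ i →
    sumFin (λ l → extend P l i * blockDiag B M (suc l) zero) ≡ blockDiag B (conj P M) (suc i) zero
  first-column zero    = extend-sumˡ-zero P (λ l → blockDiag B M (suc l) zero)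
  first-column (suc i) = trans (extend-sumˡ-suc P i (λ l → blockDiag B M (suc l) zero))
                               (sumFin-zero (λ l → ℤP.*-zeroʳ (P l i)))
conj-extend-blockDiag₂ P B M (suc i) (suc j) = begin
    conj (extend (extend P)) (blockDiag B M) (suc i) (suc j)
  ≡⟨ conj-extend (extend P) (blockDiag B M) (suc i) (suc j) ⟩
    conj (extend P) (lower (blockDiag B M)) i j
  ≡⟨ conj-cong (extend P) lower-blockDiag i j ⟩
    conj (extend P) (blockDiag (λ _ _ → B (suc zero) (suc zero)) M) i j
  ≡⟨ conj-extend-blockDiag₁ P (λ _ _ → B (suc zero) (suc zero)) M i j ⟩
    blockDiag (λ _ _ → B (suc zero) (suc zero)) (conj P M) i j
  ≡⟨ lower-blockDiag′ i j ⟩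
    blockDiag B (conj P M) (suc i) (suc j)
  ∎
  where
  lower-blockDiag : lower (blockDiag B M) ≈ blockDiag (λ _ _ → B (suc zero) (suc zero)) M
  lower-blockDiag zero    zero    = refl
  lower-blockDiag zero    (suc b) = refl
  lower-blockDiag (suc a) zero    = refl
  lower-blockDiag (suc a) (suc b) = refl
  lower-blockDiag′ : ∀ i j →
    blockDiag (λ _ _ → B (suc zero) (suc zero)) (conj P M) i j ≡ lower (blockDiag B (conj P M)) i j
  lower-blockDiag′ zero    zero    = refl
  lower-blockDiag′ zero    (suc j) = refl
  lower-blockDiag′ (suc i) zero    = refl
  lower-blockDiag′ (suc i) (suc j) = refl

-- Congruence modulo 4

infix 4 _≡₄_
record _≡₄_ (x y : ℤ) : Set where
  constructor ≡₄-intro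
  field 4∣x-y : + 4 Signed.∣ x - y

≡₄-by : ∀ {x y} z → x - y ≡ z → + 4 Signed.∣ z → x ≡₄ y
≡₄-by z eq 4∣z = ≡₄-intro (subst (+ 4 Signed.∣_) (sym eq) 4∣z)

≡⇒≡₄ : ∀ {x y} → x ≡ y → x ≡₄ y
≡⇒≡₄ {x} refl = ≡₄-intro (divides (+ 0) (ℤP.+-inverseʳ x))

≡₄-refl : ∀ {x} → x ≡₄ x
≡₄-refl = ≡⇒≡₄ refl

≡₄-sym : ∀ {x y} → x ≡₄ y → y ≡₄ x
≡₄-sym {x} {y} (≡₄-intro 4∣x-y) = ≡₄-by (- (x - y)) (flip x y) (∣m⇒∣-m 4∣x-y)
  where
  flip : ∀ x y → y - x ≡ - (x - y)
  flip = solve-∀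

≡₄-trans : ∀ {x y z} → x ≡₄ y → y ≡₄ z → x ≡₄ z
≡₄-trans {x} {y} {z} (≡₄-intro 4∣x-y) (≡₄-intro 4∣y-z) =
  ≡₄-by ((x - y) + (y - z)) (telescope x y z) (∣m∣n⇒∣m+n 4∣x-y 4∣y-z)
  where
  telescope : ∀ x y z → x - z ≡ (x - y) + (y - z)
  telescope = solve-∀

≡₄-+ : ∀ {x y u v} → x ≡₄ y → u ≡₄ v → x + u ≡₄ y + v
≡₄-+ {x} {y} {u} {v} (≡₄-intro 4∣x-y) (≡₄-intro 4∣u-v) =
  ≡₄-by ((x - y) + (u - v)) (regroup x y u v) (∣m∣n⇒∣m+n 4∣x-y 4∣u-v)
  where
  regroup : ∀ x y u v → (x + u) - (y + v) ≡ (x - y) + (u - v)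
  regroup = solve-∀

≡₄-*ˡ : ∀ c {x y} → x ≡₄ y → c * x ≡₄ c * y
≡₄-*ˡ c {x} {y} (≡₄-intro 4∣x-y) = ≡₄-by (c * (x - y)) (distrib c x y) (∣n⇒∣m*n c 4∣x-y)
  where
  distrib : ∀ c x y → c * x - c * y ≡ c * (x - y)
  distrib = solve-∀

≡₄-*ʳ : ∀ c {x y} → x ≡₄ y → x * c ≡₄ y * c
≡₄-*ʳ c {x} {y} x≡₄y rewrite ℤP.*-comm x c | ℤP.*-comm y c = ≡₄-*ˡ c x≡₄y

≡₄-sumFin : ∀ {n} {f g : Fin n → ℤ} → (∀ i → f i ≡₄ g i) → sumFin f ≡₄ sumFin g
≡₄-sumFin {zero}  f≡₄g = ≡₄-refl
≡₄-sumFin {suc n} f≡₄g = ≡₄-+ (f≡₄g zero) (≡₄-sumFin (f≡₄g ∘ suc))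

≡₄-elim : ∀ {x y} → x ≡₄ y → ∃ λ k → x ≡ y + k * + 4
≡₄-elim {x} {y} (≡₄-intro (divides k eq)) = k , trans (sym (cancel x y)) (cong (_+_ y) eq)
  where
  cancel : ∀ x y → y + (x - y) ≡ x
  cancel = solve-∀

multiple-of-4 : ∀ {z} k → z ≡ k * + 4 → z ≡₄ + 0
multiple-of-4 {z} k eq = ≡₄-intro (divides k (trans (ℤP.+-identityʳ z) eq))

4≡₄0 : + 4 ≡₄ + 0
4≡₄0 = multiple-of-4 (+ 1) refl

-- On -[1+ 4 + m] both sides compute the remainder of suc m, so the last case holds by refl.
mod4-+4 : ∀ z → mod4 (z + + 4) ≡ mod4 z
mod4-+4 (+ n)                          = cong +_ (ℕD.[m+n]%n≡m%n n 4)
mod4-+4 -[1+ 0 ]                       = refl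
mod4-+4 -[1+ 1 ]                       = refl
mod4-+4 -[1+ 2 ]                       = refl
mod4-+4 -[1+ 3 ]                       = refl
mod4-+4 -[1+ suc (suc (suc (suc m))) ] = refl

mod4-+4* : ∀ z k → mod4 (z + + k * + 4) ≡ mod4 z
mod4-+4* z zero    = cong mod4 (ℤP.+-identityʳ z)
mod4-+4* z (suc k) = trans (cong mod4 (shift z (+ k))) (trans (mod4-+4 (z + + k * + 4)) (mod4-+4* z k))
  where
  shift : ∀ z k → z + (+ 1 + k) * + 4 ≡ z + k * + 4 + + 4
  shift = solve-∀

mod4-cong : ∀ {x y} → x ≡₄ y → mod4 x ≡ mod4 y
mod4-cong {x} {y} x≡₄y with ≡₄-elim x≡₄y
... | + k      , x≡y+4k = trans (cong mod4 x≡y+4k) (mod4-+4* y k)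
... | -[1+ k ] , x≡y-4k = sym (trans (cong mod4 y≡x+4k) (mod4-+4* x (suc k)))
  where
  shift : ∀ y q → y ≡ y + - q * + 4 + q * + 4
  shift = solve-∀
  y≡x+4k : y ≡ x + + suc k * + 4
  y≡x+4k = trans (shift y (+ suc k)) (cong (_+ + suc k * + 4) (sym x≡y-4k))

≡₄-distinct : ∀ {x a b} → x ≡₄ + a → x ≡₄ + b → mod4 (+ a) ≡ mod4 (+ b)
≡₄-distinct x≡₄a x≡₄b = trans (sym (mod4-cong x≡₄a)) (mod4-cong x≡₄b)

residue : ∀ x → x ≡₄ + 0 ⊎ x ≡₄ + 1 ⊎ x ≡₄ + 2 ⊎ x ≡₄ + 3
residue x = by-remainder (x %ℕ 4) (ℤD.n%ℕd<d x 4) x≡₄r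
  where
  x≡₄r : x ≡₄ + (x %ℕ 4)
  x≡₄r = ≡₄-by ((x /ℕ 4) * + 4)
               (trans (cong (_- + (x %ℕ 4)) (ℤD.a≡a%ℕn+[a/ℕn]*n x 4)) (cancel (+ (x %ℕ 4)) ((x /ℕ 4) * + 4)))
               (divides (x /ℕ 4) refl)
    where
    cancel : ∀ r q → r + q - r ≡ q
    cancel = solve-∀
  by-remainder : ∀ r → r ℕ.< 4 → x ≡₄ + r → x ≡₄ + 0 ⊎ x ≡₄ + 1 ⊎ x ≡₄ + 2 ⊎ x ≡₄ + 3
  by-remainder 0 _ x≡₄r = inj₁ x≡₄r
  by-remainder 1 _ x≡₄r = inj₂ (inj₁ x≡₄r)
  by-remainder 2 _ x≡₄r = inj₂ (inj₂ (inj₁ x≡₄r))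
  by-remainder 3 _ x≡₄r = inj₂ (inj₂ (inj₂ x≡₄r))
  by-remainder (suc (suc (suc (suc _)))) (ℕ.s≤s (ℕ.s≤s (ℕ.s≤s (ℕ.s≤s ())))) _

Even : ℤ → Set
Even x = + 2 Signed.∣ x

Odd : ℤ → Set
Odd x = x ≡₄ + 1 ⊎ x ≡₄ + 3

even-by-≡₄ : ∀ {x y} → x ≡₄ y → Even y → Even x
even-by-≡₄ {x} {y} (≡₄-intro 4∣x-y) 2∣y =
  subst Even (cancel x y) (∣m∣n⇒∣m+n (∣-trans (divides (+ 2) refl) 4∣x-y) 2∣y)
  where
  cancel : ∀ x y → x - y + y ≡ x
  cancel = solve-∀

even⇒¬odd : ∀ {x} → Even x → ¬ Odd x
even⇒¬odd 2∣x (inj₁ x≡₄1) = 2∤1 (even-by-≡₄ (≡₄-sym x≡₄1) 2∣x)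
  where
  2∤1 : ¬ Even (+ 1)
  2∤1 (divides (+ 0) ())
  2∤1 (divides +[1+ _ ] ())
  2∤1 (divides -[1+ _ ] ())
even⇒¬odd 2∣x (inj₂ x≡₄3) = 2∤3 (even-by-≡₄ (≡₄-sym x≡₄3) 2∣x)
  where
  2∤3 : ¬ Even (+ 3)
  2∤3 (divides (+ 0) ())
  2∤3 (divides (+ 1) ())
  2∤3 (divides +[1+ suc _ ] ())
  2∤3 (divides -[1+ _ ] ())

even-or-odd : ∀ x → Even x ⊎ Odd x
even-or-odd x with residue x
... | inj₁ x≡₄0               = inj₁ (even-by-≡₄ x≡₄0 (divides (+ 0) refl))
... | inj₂ (inj₁ x≡₄1)        = inj₂ (inj₁ x≡₄1)
... | inj₂ (inj₂ (inj₁ x≡₄2)) = inj₁ (even-by-≡₄ x≡₄2 (divides (+ 1) refl))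
... | inj₂ (inj₂ (inj₂ x≡₄3)) = inj₂ (inj₂ x≡₄3)

odd? : ∀ x → Dec (Odd x)
odd? x with even-or-odd x
... | inj₁ even = no (even⇒¬odd even)
... | inj₂ odd  = yes odd

¬odd⇒even : ∀ {x} → ¬ Odd x → Even x
¬odd⇒even {x} ¬odd with even-or-odd x
... | inj₁ even = even
... | inj₂ odd  = ⊥-elim (¬odd odd)

even-residue : ∀ {x} → Even x → x ≡₄ + 0 ⊎ x ≡₄ + 2
even-residue {x} even with residue x
... | inj₁ x≡₄0               = inj₁ x≡₄0
... | inj₂ (inj₁ x≡₄1)        = ⊥-elim (even⇒¬odd even (inj₁ x≡₄1))
... | inj₂ (inj₂ (inj₁ x≡₄2)) = inj₂ x≡₄2
... | inj₂ (inj₂ (inj₂ x≡₄3)) = ⊥-elim (even⇒¬odd even (inj₂ x≡₄3))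

even-+ : ∀ {x y} → Even x → Even y → Even (x + y)
even-+ = ∣m∣n⇒∣m+n

even-* : ∀ x {y} → Even y → Even (x * y)
even-* x = ∣n⇒∣m*n x

even-double : ∀ x → Even (x + x)
even-double x = divides x (double x)
  where
  double : ∀ x → x + x ≡ x * + 2
  double = solve-∀

even+odd : ∀ {x y} → Even x → Odd y → Odd (x + y)
even+odd even odd with even-residue even | odd
... | inj₁ x≡₄0 | inj₁ y≡₄1 = inj₁ (≡₄-+ x≡₄0 y≡₄1)
... | inj₁ x≡₄0 | inj₂ y≡₄3 = inj₂ (≡₄-+ x≡₄0 y≡₄3)
... | inj₂ x≡₄2 | inj₁ y≡₄1 = inj₂ (≡₄-+ x≡₄2 y≡₄1)
... | inj₂ x≡₄2 | inj₂ y≡₄3 = inj₁ (≡₄-trans (≡₄-+ x≡₄2 y≡₄3) (≡₄-+ 4≡₄0 (≡₄-refl {+ 1})))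

odd-double : ∀ {u} → Odd u → u + u ≡₄ + 2
odd-double (inj₁ u≡₄1) = ≡₄-+ u≡₄1 u≡₄1
odd-double (inj₂ u≡₄3) = ≡₄-trans (≡₄-+ u≡₄3 u≡₄3) (≡₄-+ 4≡₄0 (≡₄-refl {+ 2}))

-- x y - u² ≡ -1 (mod 4), so the adjugate of the plane [[x, u], [u, y]] inverts it modulo 4.
odd-plane-det : ∀ {u x y} → Odd u → Even x → Even y → + 1 - u * u + x * y ≡₄ + 0
odd-plane-det {u} odd (divides a refl) (divides b refl) with odd
... | inj₁ u≡₄1 = let (k , u≡1+4k) = ≡₄-elim u≡₄1 in
  multiple-of-4 (a * b - k - k - + 4 * k * k)
                (trans (cong (λ v → + 1 - v * v + a * + 2 * (b * + 2)) u≡1+4k) (expand k a b))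
  where
  expand : ∀ k a b →
    + 1 - (+ 1 + k * + 4) * (+ 1 + k * + 4) + a * + 2 * (b * + 2) ≡ (a * b - k - k - + 4 * k * k) * + 4
  expand = solve-∀
... | inj₂ u≡₄3 = let (k , u≡3+4k) = ≡₄-elim u≡₄3 in
  multiple-of-4 (a * b - + 2 - + 6 * k - + 4 * k * k)
                (trans (cong (λ v → + 1 - v * v + a * + 2 * (b * + 2)) u≡3+4k) (expand k a b))
  where
  expand : ∀ k a b →
    + 1 - (+ 3 + k * + 4) * (+ 3 + k * + 4) + a * + 2 * (b * + 2) ≡ (a * b - + 2 - + 6 * k - + 4 * k * k) * + 4
  expand = solve-∀

-- Normal forms modulo 4

blockDiag-assoc₁ : ∀ {k w} (B : Mat 1) (C : Mat k) (W : Mat w) →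
  blockDiag (blockDiag B C) W ≈ blockDiag B (blockDiag C W)
blockDiag-assoc₁ B C W zero zero = refl
blockDiag-assoc₁ {k} B C W zero (suc j) with splitAt k j
... | inj₁ _ = refl
... | inj₂ _ = refl
blockDiag-assoc₁ {k} B C W (suc i) zero with splitAt k i
... | inj₁ _ = refl
... | inj₂ _ = refl
blockDiag-assoc₁ {k} B C W (suc i) (suc j) with splitAt k i | splitAt k j
... | inj₁ _ | inj₁ _ = refl
... | inj₁ _ | inj₂ _ = refl
... | inj₂ _ | inj₁ _ = refl
... | inj₂ _ | inj₂ _ = refl

blockDiag-assoc₂ : ∀ {k w} (B : Mat 2) (C : Mat k) (W : Mat w) →
  blockDiag (blockDiag B C) W ≈ blockDiag B (blockDiag C W)
blockDiag-assoc₂ B C W zero          zero          = refl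
blockDiag-assoc₂ B C W zero          (suc zero)    = refl
blockDiag-assoc₂ B C W (suc zero)    zero          = refl
blockDiag-assoc₂ B C W (suc zero)    (suc zero)    = refl
blockDiag-assoc₂ {k} B C W zero (suc (suc j)) with splitAt k j
... | inj₁ _ = refl
... | inj₂ _ = refl
blockDiag-assoc₂ {k} B C W (suc zero) (suc (suc j)) with splitAt k j
... | inj₁ _ = refl
... | inj₂ _ = refl
blockDiag-assoc₂ {k} B C W (suc (suc i)) zero with splitAt k i
... | inj₁ _ = refl
... | inj₂ _ = refl
blockDiag-assoc₂ {k} B C W (suc (suc i)) (suc zero) with splitAt k i
... | inj₁ _ = refl
... | inj₂ _ = refl
blockDiag-assoc₂ {k} B C W (suc (suc i)) (suc (suc j)) with splitAt k i | splitAt k j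
... | inj₁ _ | inj₁ _ = refl
... | inj₁ _ | inj₂ _ = refl
... | inj₂ _ | inj₁ _ = refl
... | inj₂ _ | inj₂ _ = refl

infix 4 _≋₄_
_≋₄_ : ∀ {n} → Mat n → Mat n → Set
X ≋₄ Y = ∀ i j → X i j ≡₄ Y i j

≈⇒≋₄ : ∀ {n} {X Y : Mat n} → X ≈ Y → X ≋₄ Y
≈⇒≋₄ X≈Y i j = ≡⇒≡₄ (X≈Y i j)

conj-≋₄ : ∀ {n} (P : Mat n) {A B : Mat n} → A ≋₄ B → conj P A ≋₄ conj P B
conj-≋₄ P A≋B i j =
  ≡₄-sumFin (λ m → ≡₄-*ʳ (P m j) (≡₄-sumFin (λ l → ≡₄-*ˡ (P l i) (A≋B l m))))

blockDiag-≋₄ : ∀ {a b} {B B′ : Mat a} {M M′ : Mat b} →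
  B ≋₄ B′ → M ≋₄ M′ → blockDiag B M ≋₄ blockDiag B′ M′
blockDiag-≋₄ {a} B≋B′ M≋M′ i j with splitAt a i | splitAt a j
... | inj₁ i′ | inj₁ j′ = B≋B′ i′ j′
... | inj₁ _  | inj₂ _  = ≡₄-refl
... | inj₂ _  | inj₁ _  = ≡₄-refl
... | inj₂ i′ | inj₂ j′ = M≋M′ i′ j′

record NormalFormMod4 {n} (r s : ℕ) (X : Mat n) : Set where
  constructor normalFormMod4
  field
    p m        : ℕ
    Z          : Mat m
    Z-sym      : ∀ i j → Z i j ≡ Z j i
    Z-diagonal : ∀ i → Z i i ≡ + 0
    Z-entries  : ∀ i j → Z i j ≢ + 0 → Z i j ≡ + 2
    size       : r ℕ.* 2 ℕ.+ (s ℕ.* 2 ℕ.+ (p ℕ.* 1 ℕ.+ m)) ≡ n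
    entries    : ∀ i j → mod4 (X i j) ≡ normalForm r s p Z (cast (sym size) i) (cast (sym size) j)

normalFormMod4-≋₄ : ∀ {n r s} {X Y : Mat n} → X ≋₄ Y → NormalFormMod4 r s Y → NormalFormMod4 r s X
normalFormMod4-≋₄ X≋Y (normalFormMod4 p m Z Zsym Zdiag Z∈02 eq nf) =
  normalFormMod4 p m Z Zsym Zdiag Z∈02 eq λ i j → trans (mod4-cong (X≋Y i j)) (nf i j)

ReducedMod4 : ∀ {n} → Mat n → Set
ReducedMod4 B = ∀ i j → mod4 (B i j) ≡ B i j

mod4-blockDiag₂ : ∀ {n n′} (B : Mat 2) → ReducedMod4 B → {X : Mat n} {Y : Mat n′} .(eq : n′ ≡ n) →
  (∀ i j → mod4 (X i j) ≡ Y (cast (sym eq) i) (cast (sym eq) j)) →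
  ∀ i j → mod4 (blockDiag B X i j)
          ≡ blockDiag B Y (cast (sym (cong (2 ℕ.+_) eq)) i) (cast (sym (cong (2 ℕ.+_) eq)) j)
mod4-blockDiag₂ B red eq X≡Y zero          zero          = red zero zero
mod4-blockDiag₂ B red eq X≡Y zero          (suc zero)    = red zero (suc zero)
mod4-blockDiag₂ B red eq X≡Y (suc zero)    zero          = red (suc zero) zero
mod4-blockDiag₂ B red eq X≡Y (suc zero)    (suc zero)    = red (suc zero) (suc zero)
mod4-blockDiag₂ B red eq X≡Y zero          (suc (suc j)) = refl
mod4-blockDiag₂ B red eq X≡Y (suc zero)    (suc (suc j)) = refl
mod4-blockDiag₂ B red eq X≡Y (suc (suc i)) zero          = refl
mod4-blockDiag₂ B red eq X≡Y (suc (suc i)) (suc zero)    = refl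
mod4-blockDiag₂ B red eq X≡Y (suc (suc i)) (suc (suc j)) = X≡Y i j

mod4-blockDiag₁ : ∀ {n n′} (B : Mat 1) → ReducedMod4 B → {X : Mat n} {Y : Mat n′} .(eq : n′ ≡ n) →
  (∀ i j → mod4 (X i j) ≡ Y (cast (sym eq) i) (cast (sym eq) j)) →
  ∀ i j → mod4 (blockDiag B X i j) ≡ blockDiag B Y (cast (sym (cong suc eq)) i) (cast (sym (cong suc eq)) j)
mod4-blockDiag₁ B red eq X≡Y zero    zero    = red zero zero
mod4-blockDiag₁ B red eq X≡Y zero    (suc j) = refl
mod4-blockDiag₁ B red eq X≡Y (suc i) zero    = refl
mod4-blockDiag₁ B red eq X≡Y (suc i) (suc j) = X≡Y i j

H₂-reduced : ReducedMod4 H₂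
H₂-reduced zero    zero    = refl
H₂-reduced zero    (suc _) = refl
H₂-reduced (suc _) zero    = refl
H₂-reduced (suc _) (suc _) = refl

U₂-reduced : ReducedMod4 U₂
U₂-reduced zero    zero    = refl
U₂-reduced zero    (suc _) = refl
U₂-reduced (suc _) zero    = refl
U₂-reduced (suc _) (suc _) = refl

T₁-reduced : ReducedMod4 T₁
T₁-reduced zero zero = refl

normalFormMod4-H : ∀ {n r s} {X : Mat n} → NormalFormMod4 r s X → NormalFormMod4 (suc r) s (blockDiag H₂ X)
normalFormMod4-H {r = r} {s} (normalFormMod4 p m Z Zsym Zdiag Z∈02 eq nf) =
  normalFormMod4 p m Z Zsym Zdiag Z∈02 (cong (2 ℕ.+_) eq) λ i j →
    trans (mod4-blockDiag₂ H₂ H₂-reduced {Y = normalForm r s p Z} eq nf i j)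
          (sym (blockDiag-assoc₂ H₂ (copies r H₂) (blockDiag (copies s U₂) (blockDiag (copies p T₁) Z))
                                 (cast _ i) (cast _ j)))

normalFormMod4-U : ∀ {n s} {X : Mat n} → NormalFormMod4 0 s X → NormalFormMod4 0 (suc s) (blockDiag U₂ X)
normalFormMod4-U {s = s} (normalFormMod4 p m Z Zsym Zdiag Z∈02 eq nf) =
  normalFormMod4 p m Z Zsym Zdiag Z∈02 (cong (2 ℕ.+_) eq) λ i j →
    trans (mod4-blockDiag₂ U₂ U₂-reduced {Y = normalForm 0 s p Z} eq nf i j)
          (sym (blockDiag-assoc₂ U₂ (copies s U₂) (blockDiag (copies p T₁) Z) (cast _ i) (cast _ j)))

normalFormMod4-T : ∀ {n} {X : Mat n} → NormalFormMod4 0 0 X → NormalFormMod4 0 0 (blockDiag T₁ X)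
normalFormMod4-T (normalFormMod4 p m Z Zsym Zdiag Z∈02 eq nf) =
  normalFormMod4 (suc p) m Z Zsym Zdiag Z∈02 (cong suc eq) λ i j →
    trans (mod4-blockDiag₁ T₁ T₁-reduced {Y = normalForm 0 0 p Z} eq nf i j)
          (sym (blockDiag-assoc₁ T₁ (copies p T₁) Z (cast _ i) (cast _ j)))

record Reduces {n} (r s : ℕ) (A : Mat n) : Set where
  constructor reduction
  field
    P          : Mat n
    unimodular : Unimodular P
    normal     : NormalFormMod4 r s (conj P A)

reduces-≋₄ : ∀ {n r s} {A B : Mat n} → A ≋₄ B → Reduces r s B → Reduces r s A
reduces-≋₄ A≋B (reduction P uni nf) = reduction P uni (normalFormMod4-≋₄ (conj-≋₄ P A≋B) nf)

reduces-shear : ∀ {n r s} {A : Mat n} {l c} → Admissible l c → Reduces r s (conj (shear l c) A) → Reduces r s A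
reduces-shear {A = A} {l} {c} adm (reduction P uni nf) =
  reduction (shear l c ⊗ P) (unimodular-shear-⊗ l c P adm uni)
            (normalFormMod4-≋₄ (≈⇒≋₄ (conj-⊗ (shear l c) P A)) nf)

reduces-blockDiag₁ : ∀ {n r s r′ s′} (B : Mat 1) {M : Mat n} →
  (∀ {X : Mat n} → NormalFormMod4 r s X → NormalFormMod4 r′ s′ (blockDiag B X)) →
  Reduces r s M → Reduces r′ s′ (blockDiag B M)
reduces-blockDiag₁ B {M} step (reduction P uni nf) =
  reduction (extend P) (unimodular-extend P uni)
            (normalFormMod4-≋₄ (≈⇒≋₄ (conj-extend-blockDiag₁ P B M)) (step nf))

reduces-blockDiag₂ : ∀ {n r s r′ s′} (B : Mat 2) {M : Mat n} →
  (∀ {X : Mat n} → NormalFormMod4 r s X → NormalFormMod4 r′ s′ (blockDiag B X)) →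
  Reduces r s M → Reduces r′ s′ (blockDiag B M)
reduces-blockDiag₂ B {M} step (reduction P uni nf) =
  reduction (extend (extend P)) (unimodular-extend (extend P) (unimodular-extend P uni))
    (normalFormMod4-≋₄ (≈⇒≋₄ (conj-extend-blockDiag₂ P B M)) (step nf))

-- Shears

sheared : ∀ {n} → Mat n → Fin n → (Fin n → ℤ) → Mat n
sheared A l c j k = A j k + c j * A l k + c k * A j l + c j * c k * A l l

sumFin-shear : ∀ {n} (l j : Fin n) (x : ℤ) (f : Fin n → ℤ) →
  sumFin (λ a → (δ a j + δ a l * x) * f a) ≡ f j + x * f l
sumFin-shear l j x f = begin
    sumFin (λ a → (δ a j + δ a l * x) * f a)
  ≡⟨ sumFin-cong (λ a → expand (δ a j) (δ a l) x (f a)) ⟩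
    sumFin (λ a → δ a j * f a + x * (δ a l * f a))
  ≡⟨ sumFin-+ (λ a → δ a j * f a) (λ a → x * (δ a l * f a)) ⟩
    sumFin (λ a → δ a j * f a) + sumFin (λ a → x * (δ a l * f a))
  ≡⟨ cong₂ _+_ (sumFin-δˡ j f) (trans (sumFin-*ˡ x (λ a → δ a l * f a)) (cong (x *_) (sumFin-δˡ l f))) ⟩
    f j + x * f l
  ∎
  where
  expand : ∀ d e x y → (d + e * x) * y ≡ d * y + x * (e * y)
  expand = solve-∀

conj-shear : ∀ {n} (A : Mat n) l c → conj (shear l c) A ≈ sheared A l c
conj-shear A l c j k = begin
    sumFin (λ m → sumFin (λ a → (δ a j + δ a l * c j) * A a m) * (δ m k + δ m l * c k))
  ≡⟨ sumFin-cong (λ m → trans (cong (_* (δ m k + δ m l * c k)) (sumFin-shear l j (c j) (λ a → A a m)))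
                              (ℤP.*-comm (A j m + c j * A l m) _)) ⟩
    sumFin (λ m → (δ m k + δ m l * c k) * (A j m + c j * A l m))
  ≡⟨ sumFin-shear l k (c k) (λ m → A j m + c j * A l m) ⟩
    A j k + c j * A l k + c k * (A j l + c j * A l l)
  ≡⟨ expand (A j k) (c j) (A l k) (c k) (A j l) (A l l) ⟩
    sheared A l c j k
  ∎
  where
  expand : ∀ a cj b ck d e → a + cj * b + ck * (d + cj * e) ≡ a + cj * b + ck * d + cj * ck * e
  expand = solve-∀

infix 4 _≼_
_≼_ : ∀ {n} → Mat n → Mat n → Set
A ≼ B = ∀ {r s} → Reduces r s B → Reduces r s A

≼-sheared : ∀ {n} {A : Mat n} l c → Admissible l c → A ≼ sheared A l c
≼-sheared {A = A} l c adm R = reduces-shear adm (reduces-≋₄ (≈⇒≋₄ (conj-shear A l c)) R)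

Symmetric : ∀ {n} → Mat n → Set
Symmetric A = ∀ i j → A i j ≡ A j i

EvenDiagonal : ∀ {n} → Mat n → Set
EvenDiagonal A = ∀ i → Even (A i i)

AllEven : ∀ {n} → Mat n → Set
AllEven A = ∀ i j → Even (A i j)

sheared-symmetric : ∀ {n} {A : Mat n} → Symmetric A → ∀ l c → Symmetric (sheared A l c)
sheared-symmetric {A = A} sym-A l c j k = begin
    A j k + c j * A l k + c k * A j l + c j * c k * A l l
  ≡⟨ cong₂ (λ u v → u + c j * A l k + c k * v + c j * c k * A l l) (sym-A j k) (sym-A j l) ⟩
    A k j + c j * A l k + c k * A l j + c j * c k * A l l
  ≡⟨ cong (λ u → A k j + c j * u + c k * A l j + c j * c k * A l l) (sym-A l k) ⟩
    A k j + c j * A k l + c k * A l j + c j * c k * A l l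
  ≡⟨ swap (A k j) (c j) (A k l) (c k) (A l j) (A l l) ⟩
    A k j + c k * A l j + c j * A k l + c k * c j * A l l
  ∎
  where
  swap : ∀ a x b y d e → a + x * b + y * d + x * y * e ≡ a + y * d + x * b + y * x * e
  swap = solve-∀

sheared-evenDiagonal : ∀ {n} {A : Mat n} → Symmetric A → EvenDiagonal A → ∀ l c → EvenDiagonal (sheared A l c)
sheared-evenDiagonal {A = A} sym-A ev l c j =
  subst Even (regroup (A j j) (c j) (A l j) (A j l) (A l l))
    (even-+ (even-+ (ev j) (subst (λ v → Even (c j * A l j + c j * v)) (sym-A l j) (even-double (c j * A l j))))
            (even-* (c j * c j) (ev l)))
  where
  regroup : ∀ a x b b′ e → a + (x * b + x * b′) + x * x * e ≡ a + x * b + x * b′ + x * x * e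
  regroup = solve-∀

sheared-allEven : ∀ {n} {A : Mat n} → AllEven A → ∀ l c → AllEven (sheared A l c)
sheared-allEven {A = A} ev l c j k =
  even-+ (even-+ (even-+ (ev j k) (even-* (c j) (ev l k))) (even-* (c k) (ev j l))) (even-* (c j * c k) (ev l l))

sheared-≡₄ : ∀ {n} (A : Mat n) l c j k {a b d e} →
  A j k ≡₄ a → A l k ≡₄ b → A j l ≡₄ d → A l l ≡₄ e →
  sheared A l c j k ≡₄ a + c j * b + c k * d + c j * c k * e
sheared-≡₄ A l c j k Ajk Alk Ajl All =
  ≡₄-+ (≡₄-+ (≡₄-+ Ajk (≡₄-*ˡ (c j) Alk)) (≡₄-*ˡ (c k) Ajl)) (≡₄-*ˡ (c j * c k) All)

-- Matrices with all entries even

even-two? : ∀ {x} → Even x → Dec (x ≡₄ + 2)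
even-two? even with even-residue even
... | inj₁ x≡₄0 = no (λ x≡₄2 → 0≢2 (≡₄-distinct x≡₄0 x≡₄2))
  where
  0≢2 : ¬ (+ 0 ≡ + 2)
  0≢2 ()
... | inj₂ x≡₄2 = yes x≡₄2

even-not-two : ∀ {x} → Even x → ¬ (x ≡₄ + 2) → x ≡₄ + 0
even-not-two even x≢2 with even-residue even
... | inj₁ x≡₄0 = x≡₄0
... | inj₂ x≡₄2 = ⊥-elim (x≢2 x≡₄2)

reduce-zero-diagonal : ∀ {n} (A : Mat n) → Symmetric A → AllEven A → (∀ i → A i i ≡₄ + 0) → Reduces 0 0 A
reduce-zero-diagonal {n} A sym-A ev diag≡₄0 =
  reduction Id (unimodular-Id {n})
    (normalFormMod4 0 n Z (λ i j → cong mod4 (sym-A i j)) (λ i → mod4-cong (diag≡₄0 i)) Z∈02 refl nf)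
  where
  Z : Mat n
  Z i j = mod4 (A i j)
  Z∈02 : ∀ i j → Z i j ≢ + 0 → Z i j ≡ + 2
  Z∈02 i j Zij≢0 with even-residue (ev i j)
  ... | inj₁ Aij≡₄0 = ⊥-elim (Zij≢0 (mod4-cong Aij≡₄0))
  ... | inj₂ Aij≡₄2 = mod4-cong Aij≡₄2
  nf : ∀ i j → mod4 (conj Id A i j) ≡ Z (cast refl i) (cast refl j)
  nf i j = trans (cong mod4 (conj-Id A i j)) (cong₂ Z (sym (cast-is-id refl i)) (sym (cast-is-id refl j)))

even-double-≡₄0 : ∀ {x} → Even x → x + x ≡₄ + 0
even-double-≡₄0 {x} (divides h refl) = multiple-of-4 h (double h)
  where
  double : ∀ h → h * + 2 + h * + 2 ≡ h * + 4
  double = solve-∀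

split-two : ∀ {n} (A : Mat (suc n)) → Symmetric A → AllEven A → A zero zero ≡₄ + 2 →
  Σ (Mat n) λ M → Symmetric M × AllEven M × A ≼ blockDiag T₁ M
split-two {n} A sym-A ev A₀₀≡₄2 =
  lower A′ , (λ a b → sym′ (suc a) (suc b)) , (λ a b → ev′ (suc a) (suc b)) ,
  λ R → ≼-sheared zero c (inj₁ refl) (reduces-≋₄ blocks R)
  where
  -- A_k0 = 2 h_k and A₀₀ ≡ 2, so f_k = e_k - h_k e₀ is orthogonal to e₀ modulo 4.
  c : Fin (suc n) → ℤ
  c zero    = + 0
  c (suc k) = - quotient (ev (suc k) zero)
  A′ : Mat (suc n)
  A′ = sheared A zero c
  sym′ : Symmetric A′
  sym′ = sheared-symmetric sym-A zero c
  ev′ : AllEven A′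
  ev′ = sheared-allEven ev zero c
  column : ∀ k → A′ (suc k) zero ≡₄ + 0
  column k = ≡₄-trans (sheared-≡₄ A zero c (suc k) zero ≡₄-refl A₀₀≡₄2 ≡₄-refl A₀₀≡₄2)
                      (≡⇒≡₄ (cancel (A (suc k) zero) (quotient (ev (suc k) zero))
                                    (Signed._∣_.equality (ev (suc k) zero))))
    where
    cancel : ∀ a h → a ≡ h * + 2 → a + - h * + 2 + + 0 * a + - h * + 0 * + 2 ≡ + 0
    cancel a h refl = vanish h
      where
      vanish : ∀ h → h * + 2 + - h * + 2 + + 0 * (h * + 2) + - h * + 0 * + 2 ≡ + 0
      vanish = solve-∀
  blocks : A′ ≋₄ blockDiag T₁ (lower A′)
  blocks zero    zero    = ≡₄-trans (≡⇒≡₄ (unchanged (A zero zero))) A₀₀≡₄2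
    where
    unchanged : ∀ a → a + + 0 * a + + 0 * a + + 0 * + 0 * a ≡ a
    unchanged = solve-∀
  blocks zero    (suc j) = ≡₄-trans (≡⇒≡₄ (sym′ zero (suc j))) (column j)
  blocks (suc i) zero    = column i
  blocks (suc i) (suc j) = ≡₄-refl

reduce-even : ∀ {n} (A : Mat n) → Symmetric A → AllEven A → Reduces 0 0 A
reduce-even {zero}  A sym-A ev = reduce-zero-diagonal A sym-A ev (λ ())
reduce-even {suc n} A sym-A ev = reduce (any? (λ i → even-two? (ev i i)))
  where
  split : (B : Mat (suc n)) → Symmetric B → AllEven B → B zero zero ≡₄ + 2 → Reduces 0 0 B
  split B sym-B ev-B two = let (M , sym-M , ev-M , B≼) = split-two B sym-B ev-B two in
    B≼ (reduces-blockDiag₁ T₁ normalFormMod4-T (reduce-even M sym-M ev-M))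
  reduce : Dec (∃ λ i → A i i ≡₄ + 2) → Reduces 0 0 A
  reduce (no none) = reduce-zero-diagonal A sym-A ev (λ i → even-not-two (ev i i) (λ two → none (i , two)))
  reduce (yes (zero , A₀₀≡₄2)) = split A sym-A ev A₀₀≡₄2
  reduce (yes (suc i , Aᵢᵢ≡₄2)) with even-two? (ev zero zero)
  ... | yes A₀₀≡₄2 = split A sym-A ev A₀₀≡₄2
  -- f₀ = e₀ + eᵢ has f₀² = A₀₀ + 2 A_i0 + A_ii ≡ 0 + 0 + 2.
  ... | no A₀₀≢2 = ≼-sheared (suc i) (δ zero) (inj₁ refl)
                     (split (sheared A (suc i) (δ zero)) (sheared-symmetric sym-A (suc i) (δ zero))
                            (sheared-allEven ev (suc i) (δ zero)) corner)
    where
    regroup : ∀ x → + 0 + + 1 * x + + 1 * x + + 1 * + 1 * + 2 ≡ (x + x) + + 2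
    regroup = solve-∀
    corner : sheared A (suc i) (δ zero) zero zero ≡₄ + 2
    corner = ≡₄-trans (sheared-≡₄ A (suc i) (δ zero) zero zero (even-not-two (ev zero zero) A₀₀≢2) ≡₄-refl
                                  (≡⇒≡₄ (sym-A zero (suc i))) Aᵢᵢ≡₄2)
                      (≡₄-trans (≡⇒≡₄ (regroup (A (suc i) zero)))
                                (≡₄-+ (even-double-≡₄0 (ev (suc i) zero)) ≡₄-refl))

-- Matrices with an odd entry

corner : ∀ {n} → Mat (suc (suc n)) → Mat 2
corner {n} A i j = A (i ↑ˡ n) (j ↑ˡ n)

module PlaneSplitting {n} (A : Mat (suc (suc n))) (sym-A : Symmetric A) (ev : EvenDiagonal A)
                      (odd : Odd (A zero (suc zero))) where

  x u y : ℤ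
  x = A zero zero
  u = A zero (suc zero)
  y = A (suc zero) (suc zero)

  -- f_k = e_k + c_k e₀ + d_k e₁ with (c_k, d_k) = adj [[x, u], [u, y]] (A_k0, A_k1), which is
  -- orthogonal to e₀ and e₁ modulo 4.
  c : Fin (suc (suc n)) → ℤ
  c zero          = + 0
  c (suc zero)    = + 0
  c (suc (suc k)) = y * A (suc (suc k)) zero - u * A (suc (suc k)) (suc zero)

  d : Fin (suc (suc n)) → ℤ
  d zero          = + 0
  d (suc zero)    = + 0
  d (suc (suc k)) = x * A (suc (suc k)) (suc zero) - u * A (suc (suc k)) zero

  A₁ A₂ : Mat (suc (suc n))
  A₁ = sheared A zero c
  A₂ = sheared A₁ (suc zero) d

  sym₁ : Symmetric A₁
  sym₁ = sheared-symmetric sym-A zero c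

  sym₂ : Symmetric A₂
  sym₂ = sheared-symmetric sym₁ (suc zero) d

  ev₂ : EvenDiagonal A₂
  ev₂ = sheared-evenDiagonal sym₁ (sheared-evenDiagonal sym-A ev zero c) (suc zero) d

  det≡₄0 : + 1 - u * u + x * y ≡₄ + 0
  det≡₄0 = odd-plane-det odd (ev zero) (ev (suc zero))

  cleared : ∀ a → a * (+ 1 - u * u + x * y) ≡₄ + 0
  cleared a = ≡₄-trans (≡₄-*ˡ a det≡₄0) (≡⇒≡₄ (ℤP.*-zeroʳ a))

  column₀ : ∀ k → A₂ (suc (suc k)) zero ≡₄ + 0
  column₀ k = ≡₄-trans (≡⇒≡₄ (expand (A (suc (suc k)) zero) (A (suc (suc k)) (suc zero)) x y u
                                     (A (suc zero) zero) (A₁ (suc zero) (suc zero)) (sym-A (suc zero) zero)))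
                       (cleared (A (suc (suc k)) zero))
    where
    expand : ∀ a b x y u u′ w → u′ ≡ u →
      (a + (y * a - u * b) * x + + 0 + (y * a - u * b) * + 0 * x)
        + (x * b - u * a) * (u′ + + 0 + + 0 + + 0) + + 0 + (x * b - u * a) * + 0 * w
      ≡ a * (+ 1 - u * u + x * y)
    expand a b x y u .u w refl = identity a b x y u w
      where
      identity : ∀ a b x y u w →
        (a + (y * a - u * b) * x + + 0 + (y * a - u * b) * + 0 * x)
          + (x * b - u * a) * (u + + 0 + + 0 + + 0) + + 0 + (x * b - u * a) * + 0 * w
        ≡ a * (+ 1 - u * u + x * y)
      identity = solve-∀

  column₁ : ∀ k → A₂ (suc (suc k)) (suc zero) ≡₄ + 0
  column₁ k = ≡₄-trans (≡⇒≡₄ (expand (A (suc (suc k)) zero) (A (suc (suc k)) (suc zero)) x y u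
                                     (A₁ (suc zero) (suc zero))))
                       (cleared (A (suc (suc k)) (suc zero)))
    where
    expand : ∀ a b x y u w →
      (b + (y * a - u * b) * u + + 0 + (y * a - u * b) * + 0 * x)
        + (x * b - u * a) * (y + + 0 + + 0 + + 0) + + 0 + (x * b - u * a) * + 0 * w
      ≡ b * (+ 1 - u * u + x * y)
    expand = solve-∀

  unchanged : ∀ z → z + + 0 + + 0 + + 0 + + 0 + + 0 + + 0 ≡ z
  unchanged = solve-∀

  blocks : A₂ ≋₄ blockDiag (corner A) (lower (lower A₂))
  blocks zero          zero          = ≡⇒≡₄ (unchanged x)
  blocks zero          (suc zero)    = ≡⇒≡₄ (unchanged u)
  blocks (suc zero)    zero          = ≡⇒≡₄ (unchanged (A (suc zero) zero))
  blocks (suc zero)    (suc zero)    = ≡⇒≡₄ (unchanged y)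
  blocks (suc (suc k)) zero          = column₀ k
  blocks (suc (suc k)) (suc zero)    = column₁ k
  blocks zero          (suc (suc k)) = ≡₄-trans (≡⇒≡₄ (sym₂ zero (suc (suc k)))) (column₀ k)
  blocks (suc zero)    (suc (suc k)) = ≡₄-trans (≡⇒≡₄ (sym₂ (suc zero) (suc (suc k)))) (column₁ k)
  blocks (suc (suc a)) (suc (suc b)) = ≡₄-refl

split-plane : ∀ {n} (A : Mat (suc (suc n))) → Symmetric A → EvenDiagonal A → Odd (A zero (suc zero)) →
  Σ (Mat n) λ M → Symmetric M × EvenDiagonal M × A ≼ blockDiag (corner A) M
split-plane A sym-A ev odd =
  lower (lower A₂) , (λ a b → sym₂ (suc (suc a)) (suc (suc b))) , (λ a → ev₂ (suc (suc a))) ,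
  λ R → ≼-sheared zero c (inj₁ refl) (≼-sheared (suc zero) d (inj₁ refl) (reduces-≋₄ blocks R))
  where open PlaneSplitting A sym-A ev odd

Classified : ∀ {n} → Mat n → Set
Classified A = ∃ λ r → ∃ λ s → Reduces r s A

Classifies : ℕ → Set
Classifies n = ∀ (M : Mat n) → Symmetric M → EvenDiagonal M → Classified M

classified-≼ : ∀ {n} {A B : Mat n} → A ≼ B → Classified B → Classified A
classified-≼ A≼B (r , s , R) = r , s , A≼B R

classified-sheared : ∀ {n} {A : Mat n} → Symmetric A → EvenDiagonal A → ∀ l c → Admissible l c →
  (Symmetric (sheared A l c) → EvenDiagonal (sheared A l c) → Classified (sheared A l c)) → Classified A
classified-sheared sym-A ev l c adm classify′ =
  classified-≼ (≼-sheared l c adm) (classify′ (sheared-symmetric sym-A l c) (sheared-evenDiagonal sym-A ev l c))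

blockDiag-symmetric : ∀ {a b} {B : Mat a} {M : Mat b} →
  Symmetric B → Symmetric M → Symmetric (blockDiag B M)
blockDiag-symmetric {a} sym-B sym-M i j with splitAt a i | splitAt a j
... | inj₁ i′ | inj₁ j′ = sym-B i′ j′
... | inj₁ _  | inj₂ _  = refl
... | inj₂ _  | inj₁ _  = refl
... | inj₂ i′ | inj₂ j′ = sym-M i′ j′

blockDiag-evenDiagonal : ∀ {a b} {B : Mat a} {M : Mat b} →
  EvenDiagonal B → EvenDiagonal M → EvenDiagonal (blockDiag B M)
blockDiag-evenDiagonal {a} ev-B ev-M i with splitAt a i
... | inj₁ i′ = ev-B i′
... | inj₂ i′ = ev-M i′

U₂-symmetric : Symmetric U₂
U₂-symmetric zero    zero    = refl
U₂-symmetric zero    (suc _) = refl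
U₂-symmetric (suc _) zero    = refl
U₂-symmetric (suc _) (suc _) = refl

U₂-evenDiagonal : EvenDiagonal U₂
U₂-evenDiagonal zero    = even-double (+ 0)
U₂-evenDiagonal (suc _) = even-double (+ 0)

H₂-symmetric : Symmetric H₂
H₂-symmetric zero    zero    = refl
H₂-symmetric zero    (suc _) = refl
H₂-symmetric (suc _) zero    = refl
H₂-symmetric (suc _) (suc _) = refl

corner-≋₄ : ∀ {n} {A : Mat (suc (suc n))} {B : Mat 2} → Symmetric A → Symmetric B →
  A zero zero ≡₄ B zero zero → A zero (suc zero) ≡₄ B zero (suc zero) →
  A (suc zero) (suc zero) ≡₄ B (suc zero) (suc zero) → corner A ≋₄ B
corner-≋₄ sym-A sym-B a₀₀ a₀₁ a₁₁ zero       zero       = a₀₀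
corner-≋₄ sym-A sym-B a₀₀ a₀₁ a₁₁ zero       (suc zero) = a₀₁
corner-≋₄ sym-A sym-B a₀₀ a₀₁ a₁₁ (suc zero) zero       =
  ≡₄-trans (≡⇒≡₄ (sym-A (suc zero) zero)) (≡₄-trans a₀₁ (≡⇒≡₄ (sym-B zero (suc zero))))
corner-≋₄ sym-A sym-B a₀₀ a₀₁ a₁₁ (suc zero) (suc zero) = a₁₁

plane : ∀ {n} → ℤ → ℤ → Fin (suc (suc n)) → ℤ
plane x y zero          = x
plane x y (suc zero)    = y
plane x y (suc (suc _)) = + 0

module _ {n} (classify : Classifies n) where

  classify-H-corner : (A : Mat (suc (suc n))) → Symmetric A → EvenDiagonal A →
    corner A ≋₄ H₂ → Classified A
  classify-H-corner A sym-A ev corner≋H₂ =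
    let (M , sym-M , ev-M , A≼) = split-plane A sym-A ev (inj₁ (corner≋H₂ zero (suc zero)))
        (r , s , R) = classify M sym-M ev-M
    in suc r , s , A≼ (reduces-≋₄ (blockDiag-≋₄ corner≋H₂ (λ _ _ → ≡₄-refl))
                                  (reduces-blockDiag₂ H₂ normalFormMod4-H R))

  -- With f₀ = e₀ + e₁ and f₁ = e₁ + a eᵢ + b eⱼ (i, j indexing M), the corner is ≡ H₂ as soon as
  -- (a eᵢ + b eⱼ)² ≡ 2.
  classify-U⊕-rebased : (M : Mat n) → Symmetric M → EvenDiagonal M → ∀ i j (a b : ℤ) →
    a * a * M i i + b * (a * M j i) + b * (a * M i j) + b * b * M j j ≡₄ + 2 → Classified (blockDiag U₂ M)
  classify-U⊕-rebased M sym-M ev-M i j a b F≡₄2 =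
    classified-sheared (blockDiag-symmetric U₂-symmetric sym-M) (blockDiag-evenDiagonal U₂-evenDiagonal ev-M)
      (suc zero) (δ zero) (inj₁ refl) λ sym₁ ev₁ →
    classified-sheared sym₁ ev₁ (suc (suc i)) (plane (+ 0) a) (inj₁ refl) λ sym₂ ev₂ →
    classified-sheared sym₂ ev₂ (suc (suc j)) (plane (+ 0) b) (inj₁ refl) λ sym₃ ev₃ →
    classify-H-corner C₃ sym₃ ev₃ (corner-≋₄ sym₃ H₂-symmetric ≡₄-refl h₀₁ h₁₁)
    where
    C₃ : Mat (suc (suc n))
    C₃ = sheared (sheared (sheared (blockDiag U₂ M) (suc zero) (δ zero)) (suc (suc i)) (plane (+ 0) a))
                 (suc (suc j)) (plane (+ 0) b)
    e₀₁ : ∀ a b → (+ 1 + + 0 + a * + 0 + + 0) + + 0 + b * + 0 + + 0 ≡ + 1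
    e₀₁ = solve-∀
    h₀₁ : C₃ zero (suc zero) ≡₄ + 1
    h₀₁ = ≡⇒≡₄ (e₀₁ a b)
    e₁₁ : ∀ a b p q r t →
      (+ 0 + a * + 0 + a * + 0 + a * a * (p + + 0 + + 0 + + 0))
      + b * (+ 0 + + 0 + a * (q + + 0 + + 0 + + 0) + + 0)
      + b * (+ 0 + a * (r + + 0 + + 0 + + 0) + + 0 + a * + 0 * (p + + 0 + + 0 + + 0))
      + b * b * ((t + + 0 + + 0 + + 0) + + 0 + + 0 + + 0)
      ≡ a * a * p + b * (a * q) + b * (a * r) + b * b * t
    e₁₁ = solve-∀
    h₁₁ : C₃ (suc zero) (suc zero) ≡₄ + 2
    h₁₁ = ≡₄-trans (≡⇒≡₄ (e₁₁ a b (M i i) (M j i) (M i j) (M j j))) F≡₄2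

  classify-U⊕ : (M : Mat n) → Symmetric M → EvenDiagonal M → Classified (blockDiag U₂ M)
  classify-U⊕ M sym-M ev-M with any? (λ i → any? (λ j → odd? (M i j)))
  ... | no none = 0 , 1 , reduces-blockDiag₂ U₂ normalFormMod4-U
                            (reduce-even M sym-M (λ i j → ¬odd⇒even (λ odd → none (i , j , odd))))
  ... | yes (i , j , odd) with even-residue (ev-M i) | even-residue (ev-M j)
  ... | inj₂ Mᵢᵢ≡₄2 | _ =
    classify-U⊕-rebased M sym-M ev-M i j (+ 1) (+ 0)
      (≡₄-trans (≡⇒≡₄ (only-first (M i i) (M j i) (M i j) (M j j))) Mᵢᵢ≡₄2)
    where
    only-first : ∀ p q r t → + 1 * + 1 * p + + 0 * (+ 1 * q) + + 0 * (+ 1 * r) + + 0 * + 0 * t ≡ p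
    only-first = solve-∀
  ... | inj₁ _ | inj₂ Mⱼⱼ≡₄2 =
    classify-U⊕-rebased M sym-M ev-M i j (+ 0) (+ 1)
      (≡₄-trans (≡⇒≡₄ (only-last (M i i) (M j i) (M i j) (M j j))) Mⱼⱼ≡₄2)
    where
    only-last : ∀ p q r t → + 0 * + 0 * p + + 1 * (+ 0 * q) + + 1 * (+ 0 * r) + + 1 * + 1 * t ≡ t
    only-last = solve-∀
  ... | inj₁ Mᵢᵢ≡₄0 | inj₁ Mⱼⱼ≡₄0 =
    classify-U⊕-rebased M sym-M ev-M i j (+ 1) (+ 1)
      (≡₄-trans (≡⇒≡₄ (regroup (M i i) (M j i) (M i j) (M j j) (sym-M j i)))
                (≡₄-+ (≡₄-+ Mᵢᵢ≡₄0 (odd-double odd)) Mⱼⱼ≡₄0))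
    where
    regroup : ∀ p q r t → q ≡ r →
      + 1 * + 1 * p + + 1 * (+ 1 * q) + + 1 * (+ 1 * r) + + 1 * + 1 * t ≡ p + (r + r) + t
    regroup p q r t refl = identity p r t
      where
      identity : ∀ p r t →
        + 1 * + 1 * p + + 1 * (+ 1 * r) + + 1 * (+ 1 * r) + + 1 * + 1 * t ≡ p + (r + r) + t
      identity = solve-∀

  classify-U-corner : (A : Mat (suc (suc n))) → Symmetric A → EvenDiagonal A →
    corner A ≋₄ U₂ → Classified A
  classify-U-corner A sym-A ev corner≋U₂ =
    let (M , sym-M , ev-M , A≼) = split-plane A sym-A ev (inj₁ (corner≋U₂ zero (suc zero)))
    in classified-≼ (λ R → A≼ (reduces-≋₄ (blockDiag-≋₄ corner≋U₂ (λ _ _ → ≡₄-refl)) R))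
                    (classify-U⊕ M sym-M ev-M)

  classify-unit-01 : (A : Mat (suc (suc n))) → Symmetric A → EvenDiagonal A →
    A zero (suc zero) ≡₄ + 1 → Classified A
  classify-unit-01 A sym-A ev A₀₁≡₄1 with even-residue (ev zero) | even-residue (ev (suc zero))
  ... | inj₂ A₀₀≡₄2 | inj₂ A₁₁≡₄2 =
    classify-H-corner A sym-A ev (corner-≋₄ sym-A H₂-symmetric A₀₀≡₄2 A₀₁≡₄1 A₁₁≡₄2)
  ... | inj₁ A₀₀≡₄0 | inj₁ A₁₁≡₄0 =
    classify-U-corner A sym-A ev (corner-≋₄ sym-A U₂-symmetric A₀₀≡₄0 A₀₁≡₄1 A₁₁≡₄0)
  -- In the mixed cases f₀ = e₀ + e₁, respectively f₁ = e₁ + e₀, makes both diagonal entries ≡ 0.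
  ... | inj₂ A₀₀≡₄2 | inj₁ A₁₁≡₄0 =
    classified-sheared sym-A ev (suc zero) c (inj₁ refl) λ sym′ ev′ →
    classify-U-corner A′ sym′ ev′ (corner-≋₄ sym′ U₂-symmetric h₀₀ h₀₁ h₁₁)
    where
    c : Fin (suc (suc n)) → ℤ
    c = plane (+ 1) (+ 0)
    A′ : Mat (suc (suc n))
    A′ = sheared A (suc zero) c
    A₁₀≡₄1 : A (suc zero) zero ≡₄ + 1
    A₁₀≡₄1 = ≡₄-trans (≡⇒≡₄ (sym-A (suc zero) zero)) A₀₁≡₄1
    h₀₀ : A′ zero zero ≡₄ + 0
    h₀₀ = ≡₄-trans (sheared-≡₄ A (suc zero) c zero zero A₀₀≡₄2 A₁₀≡₄1 A₀₁≡₄1 A₁₁≡₄0) 4≡₄0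
    h₀₁ : A′ zero (suc zero) ≡₄ + 1
    h₀₁ = sheared-≡₄ A (suc zero) c zero (suc zero) A₀₁≡₄1 A₁₁≡₄0 A₀₁≡₄1 A₁₁≡₄0
    h₁₁ : A′ (suc zero) (suc zero) ≡₄ + 0
    h₁₁ = sheared-≡₄ A (suc zero) c (suc zero) (suc zero) A₁₁≡₄0 A₁₁≡₄0 A₁₁≡₄0 A₁₁≡₄0
  ... | inj₁ A₀₀≡₄0 | inj₂ A₁₁≡₄2 =
    classified-sheared sym-A ev zero c (inj₁ refl) λ sym′ ev′ →
    classify-U-corner A′ sym′ ev′ (corner-≋₄ sym′ U₂-symmetric h₀₀ h₀₁ h₁₁)
    where
    c : Fin (suc (suc n)) → ℤ
    c = plane (+ 0) (+ 1)
    A′ : Mat (suc (suc n))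
    A′ = sheared A zero c
    A₁₀≡₄1 : A (suc zero) zero ≡₄ + 1
    A₁₀≡₄1 = ≡₄-trans (≡⇒≡₄ (sym-A (suc zero) zero)) A₀₁≡₄1
    h₀₀ : A′ zero zero ≡₄ + 0
    h₀₀ = sheared-≡₄ A zero c zero zero A₀₀≡₄0 A₀₀≡₄0 A₀₀≡₄0 A₀₀≡₄0
    h₀₁ : A′ zero (suc zero) ≡₄ + 1
    h₀₁ = sheared-≡₄ A zero c zero (suc zero) A₀₁≡₄1 A₀₁≡₄1 A₀₀≡₄0 A₀₀≡₄0
    h₁₁ : A′ (suc zero) (suc zero) ≡₄ + 0
    h₁₁ = ≡₄-trans (sheared-≡₄ A zero c (suc zero) (suc zero) A₁₁≡₄2 A₀₁≡₄1 A₁₀≡₄1 A₀₀≡₄0) 4≡₄0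

  classify-odd-01 : (A : Mat (suc (suc n))) → Symmetric A → EvenDiagonal A →
    Odd (A zero (suc zero)) → Classified A
  classify-odd-01 A sym-A ev (inj₁ A₀₁≡₄1) = classify-unit-01 A sym-A ev A₀₁≡₄1
  -- c₁ = -2 replaces e₁ by -e₁.
  classify-odd-01 A sym-A ev (inj₂ A₀₁≡₄3) =
    classified-sheared sym-A ev (suc zero) c (inj₂ refl) λ sym′ ev′ →
    classify-unit-01 (sheared A (suc zero) c) sym′ ev′
      (≡₄-trans (sheared-≡₄ A (suc zero) c zero (suc zero) A₀₁≡₄3 ≡₄-refl A₀₁≡₄3 ≡₄-refl)
                (≡₄-intro (divides (- + 1) refl)))
    where
    c : Fin (suc (suc n)) → ℤ
    c = plane (+ 0) (- + 2)

  classify-odd-row₀ : (A : Mat (suc (suc n))) → Symmetric A → EvenDiagonal A →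
    (∃ λ j → Odd (A zero j)) → Classified A
  classify-odd-row₀ A sym-A ev (j , A₀ⱼ-odd) with odd? (A zero (suc zero))
  ... | yes A₀₁-odd = classify-odd-01 A sym-A ev A₀₁-odd
  ... | no A₀₁-even = move j A₀ⱼ-odd
    where
    move : ∀ j → Odd (A zero j) → Classified A
    move zero          A₀₀-odd = ⊥-elim (even⇒¬odd (ev zero) A₀₀-odd)
    move (suc zero)    A₀₁-odd = ⊥-elim (A₀₁-even A₀₁-odd)
    move (suc (suc j)) A₀ⱼ-odd =
      classified-sheared sym-A ev (suc (suc j)) c (inj₁ refl) λ sym′ ev′ →
      classify-odd-01 (sheared A (suc (suc j)) c) sym′ ev′
        (subst Odd (sym (add (A zero (suc zero)) (A zero (suc (suc j)))))
          (even+odd (¬odd⇒even A₀₁-even) A₀ⱼ-odd))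
      where
      c : Fin (suc (suc n)) → ℤ
      c = plane (+ 0) (+ 1)
      add : ∀ u w → u + + 0 + + 1 * w + + 0 ≡ u + w
      add = solve-∀

  classify-odd : (A : Mat (suc (suc n))) → Symmetric A → EvenDiagonal A →
    (∃ λ i → ∃ λ j → Odd (A i j)) → Classified A
  classify-odd A sym-A ev (i , j , Aᵢⱼ-odd) with any? (λ j → odd? (A zero j))
  ... | yes row₀-odd = classify-odd-row₀ A sym-A ev row₀-odd
  ... | no row₀-even = move i j Aᵢⱼ-odd
    where
    move : ∀ i j → Odd (A i j) → Classified A
    move zero    j       A₀ⱼ-odd = ⊥-elim (row₀-even (j , A₀ⱼ-odd))
    move (suc i) zero    Aᵢ₀-odd = ⊥-elim (row₀-even (suc i , subst Odd (sym-A (suc i) zero) Aᵢ₀-odd))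
    move (suc i) (suc j) Aᵢⱼ-odd =
      classified-sheared sym-A ev (suc i) (δ zero) (inj₁ refl) λ sym′ ev′ →
      classify-odd-row₀ (sheared A (suc i) (δ zero)) sym′ ev′
        (suc j , subst Odd (sym (add (A zero (suc j)) (A (suc i) (suc j))))
                   (even+odd (¬odd⇒even (λ odd → row₀-even (suc j , odd))) Aᵢⱼ-odd))
      where
      add : ∀ u v → u + + 1 * v + + 0 + + 0 ≡ u + v
      add = solve-∀

classify : ∀ {n} → Classifies n
classify {n} A sym-A ev with any? (λ i → any? (λ j → odd? (A i j)))
... | no none = 0 , 0 , reduce-even A sym-A (λ i j → ¬odd⇒even (λ odd → none (i , j , odd)))
classify {suc zero}    A sym-A ev | yes (zero , zero , A₀₀-odd) = ⊥-elim (even⇒¬odd (ev zero) A₀₀-odd)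
classify {suc (suc n)} A sym-A ev | yes odd-entry = classify-odd classify A sym-A ev odd-entry

lemma2p1 : (n : ℕ) (A : Mat n) →
    (∀ i j → A i j ≡ A j i) →
    (∀ i → + 2 ∣ A i i) →
    Σ (Mat n) λ P → (det P ≡ + 1 ⊎ det P ≡ - (+ 1)) ×
      ∃ λ r → ∃ λ s → ∃ λ p → ∃ λ m → Σ (Mat m) λ Z →
        (∀ i j → Z i j ≡ Z j i) × (∀ i → Z i i ≡ + 0) ×
        (∀ i j → Z i j ≢ + 0 → Z i j ≡ + 2) ×
        Σ (r ℕ.* 2 ℕ.+ (s ℕ.* 2 ℕ.+ (p ℕ.* 1 ℕ.+ m)) ≡ n) λ eq →
          ∀ i j → mod4 ((transpose P ⊗ A ⊗ P) i j)
                  ≡ normalForm r s p Z (cast (sym eq) i) (cast (sym eq) j)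
lemma2p1 n A sym-A 2∣diagonal =
  let (r , s , reduction P unimodular (normalFormMod4 p m Z Z-sym Z-diagonal Z-entries size entries)) =
        classify A sym-A (λ i → ∣ᵤ⇒∣ (2∣diagonal i))
  in P , unimodular , r , s , p , m , Z , Z-sym , Z-diagonal , Z-entries , size , entries
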